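{- Let $G$ be a finite group such that the order supergraph $\mathcal{S}(G)$ is dominatable. Then $\mathcal{S}^{**}(G)$ is the line graph of some graph if and only if one of the following holds: (i) $G$ is a $p$-group for some prime $p$; (ii) $|G|$ has exactly two distinct prime divisors and the order of every element of $G$ is square-free.
   Context: For a finite group $G$ with identity $e$, the order supergraph $\mathcal{S}(G)$ is the simple undirected graph with vertex set $G$ in which distinct $x,y$ are adjacent if and only if $o(x)\mid o(y)$ or $o(y)\mid o(x)$, where $o(x)$ is the order of $x$. A dominating vertex is a vertex adjacent to all other vertices; $\mathcal{S}(G)$ is dominatable if it has a dominating vertex other than $e$. $\mathcal{S}^{**}(G)$ is the subgraph of $\mathcal{S}(G)$ obtained by deleting all dominating vertices of $\mathcal{S}(G)$ (including $e$). A graph is a line graph if it is isomorphic to the line graph $L(\Gamma)$ of some simple graph $\Gamma$ (vertices of $L(\Gamma)$ are the edges of $\Gamma$, adjacent when they share an endpoint); the graph with empty vertex set is regarded as a line graph. -}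

module Defs where

open import Level using (0ℓ)
open import Data.Nat using (ℕ; zero; suc; _<_; _^_)
open import Data.Nat.Divisibility using (_∣_)
open import Data.Nat.Primality using (Prime)
open import Data.Fin using (Fin)
open import Data.Product using (Σ; ∃; ∃-syntax; _×_; _,_; proj₁; proj₂)
open import Data.Sum using (_⊎_)
open import Data.Refinement using (Refinement; value)
open import Relation.Nullary using (¬_)
open import Relation.Binary.PropositionalEquality using (_≡_; _≢_)
open import Algebra.Structures using (IsGroup)
open import Function.Bundles using (_⇔_)

-- Finite groups: a group structure on Fin n (every finite group is
-- isomorphic to one of these), with propositional equality.  |G| = n.

record FiniteGroup : Set where
  field
    n       : ℕ
    _∙_     : Fin n → Fin n → Fin n
    e       : Fin n
    _⁻¹     : Fin n → Fin n
    isGroup : IsGroup _≡_ _∙_ e _⁻¹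

module _ (G : FiniteGroup) where
  open FiniteGroup G

  pow : Fin n → ℕ → Fin n
  pow x zero    = e
  pow x (suc k) = x ∙ pow x k

  IsOrder : Fin n → ℕ → Set
  IsOrder x k = 0 < k × pow x k ≡ e × (∀ j → 0 < j → j < k → pow x j ≢ e)

  OrdComparable : Fin n → Fin n → Set
  OrdComparable x y = ∀ a b → IsOrder x a → IsOrder y b → a ∣ b ⊎ b ∣ a

  SAdj : Fin n → Fin n → Set
  SAdj x y = x ≢ y × OrdComparable x y

  Dominating : Fin n → Set
  Dominating v = ∀ w → w ≢ v → SAdj v w

  Dominatable : Set
  Dominatable = ∃[ v ] (v ≢ e × Dominating v)

  S**Vertex : Set
  S**Vertex = Refinement (Fin n) (λ x → ¬ Dominating x)

  S**Adj : S**Vertex → S**Vertex → Set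
  S**Adj u v = SAdj (value u) (value v)

  IsPGroup : Set
  IsPGroup = ∃[ p ] (Prime p × ∃[ k ] (n ≡ p ^ k))

  TwoPrimeDivisors : Set
  TwoPrimeDivisors =
    ∃[ p ] ∃[ q ] (Prime p × Prime q × p ≢ q × p ∣ n × q ∣ n ×
      (∀ r → Prime r → r ∣ n → r ≡ p ⊎ r ≡ q))

  SquareFree : ℕ → Set
  SquareFree k = ∀ p → Prime p → ¬ (p Data.Nat.* p ∣ k)

  AllOrdersSquareFree : Set
  AllOrdersSquareFree = ∀ x k → IsOrder x k → SquareFree k

record SimpleGraph : Set₁ where
  field
    m     : ℕ
    E     : Fin m → Fin m → Set
    sym   : ∀ {a b} → E a b → E b a
    irrefl : ∀ {a} → ¬ E a a

SameEdge : ∀ {m} → Fin m × Fin m → Fin m × Fin m → Set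
SameEdge (a , b) (c , d) = (a ≡ c × b ≡ d) ⊎ (a ≡ d × b ≡ c)

ShareEnd : ∀ {m} → Fin m × Fin m → Fin m × Fin m → Set
ShareEnd (a , b) (c , d) = (a ≡ c ⊎ a ≡ d) ⊎ (b ≡ c ⊎ b ≡ d)

-- The graph (V, Adj) is isomorphic to the line graph L(Γ):
-- f sends each vertex to an edge of Γ, bijectively onto the edge set
-- (edges as unordered pairs), and distinct vertices are adjacent iff
-- the corresponding edges share an endpoint.
IsLineGraphOf : (V : Set) → (V → V → Set) → SimpleGraph → Set
IsLineGraphOf V Adj Γ =
  Σ (V → Fin m × Fin m) λ f →
    (∀ v → E (proj₁ (f v)) (proj₂ (f v))) ×
    (∀ u v → SameEdge (f u) (f v) → u ≡ v) ×
    (∀ a b → E a b → ∃[ v ] SameEdge (f v) (a , b)) ×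
    (∀ u v → u ≢ v → (Adj u v ⇔ ShareEnd (f u) (f v)))
  where open SimpleGraph Γ

IsLineGraph : (V : Set) → (V → V → Set) → Set₁
IsLineGraph V Adj = Σ SimpleGraph (IsLineGraphOf V Adj)

-- Let v ≠ e dominate S(G) and d = o(v).  Every prime r dividing |G| divides d: Cauchy's theorem
-- (McKay's proof: the rotation-fixed p-tuples with product e number a multiple of p) gives an
-- element of order r, whose order must be comparable with d.  So G has elements of every order
-- dividing d, and suitable elements and their inverses realise, inside S**(G), configurations
-- that no line graph contains, because an edge is determined by its two endpoints:
--   (A) a ~ x, y, s with s ≁ x, y, and two common neighbours of x ≠ y that are not adjacent to a;
--   (B) two vertices both adjacent to P ≠ P′ and x ≠ y, where P, P′ ≁ x and P ≁ y.
-- Three primes p, q, r with q odd give (A) with orders p; pq, pq; pr; q, q.  Two primes s ≠ t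
-- with s² dividing some order, hence d, give (A) with orders 2; 2t, 2t; 4; t, t if s = 2, and (B)
-- with orders s, s; s², s²; st, st if s is odd.  Conversely, in a p-group all orders are
-- comparable, so S**(G) is empty; with two primes p, q and square-free orders every
-- non-dominating element has order p or q, and S**(G) is the line graph of two disjoint stars.

module Submission where

open import Defs
open import Data.Product using (_×_)
open import Data.Sum using (_⊎_)
open import Function.Bundles using (_⇔_)

open import Algebra.Bundles using (Group)
open import Algebra.Structures using (IsGroup)
import Algebra.Properties.Group as GroupProperties
import Algebra.Properties.Monoid.Sum as MonoidSum
open import Data.Bool.Base using (Bool; true; false; T; _∧_; _∨_; not)
open import Data.Bool.Properties using (T-∧; T-∨; T-≡; ∧-zeroʳ; ∧-identityʳ)
open import Data.Empty using (⊥; ⊥-elim)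
import Data.Empty.Irrelevant as Irrelevant
open import Data.Fin.Base as Fin using (Fin; zero; suc; toℕ; _↑ˡ_; _↑ʳ_; combine; finToFun; funToFin)
open import Data.Fin.Properties as Fin
  using (pigeonhole; toℕ-injective; toℕ-fromℕ<; toℕ-fromℕ; toℕ-inject₁; toℕ<n;
         finToFun-funToFin; funToFin-finToFin; remQuot-combine)
open import Data.Irrelevant using ([_])
open import Data.List.Base using ([]; _∷_)
open import Data.List.Relation.Unary.All using (_∷_)
open import Data.Nat.Base
open import Data.Nat.Coprimality using (Coprime; coprime-Bézout; prime⇒coprime)
import Data.Nat.Coprimality as Coprimality
open import Data.Nat.Divisibility
open import Data.Nat.DivMod
  using (_%_; _/_; _mod_; m≡m%n+[m/n]*n; m%n<n; m%n%n≡m%n; [m+n]%n≡m%n; m<n⇒m%n≡m; %-distribˡ-+)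
open import Data.Nat.GCD using (module Bézout)
open import Data.Nat.GeneralisedArithmetic using (fold; fold-+)
open import Data.Nat.Induction using (<-rec)
open import Data.Nat.ListAction as List using ()
open import Data.Nat.Primality
open import Data.Nat.Primality.Factorisation using (factorise)
open import Data.Nat.Properties
open import Data.Product using (∃-syntax; _,_; proj₁; proj₂; swap)
open import Data.Refinement using (_,_; value; value-injective)
open import Data.Sum as Sum using (inj₁; inj₂)
open import Function.Base using (_∘_)
open import Function.Bundles using (Equivalence; mk⇔)
import Function.Properties.Equivalence as ⇔
open import Level using (0ℓ)
open import Relation.Binary.Definitions using (tri<; tri≈; tri>)
open import Relation.Binary.PropositionalEquality hiding ([_])
open import Relation.Nullary using (¬_; Dec; yes; no)
open import Relation.Nullary.Decidable
  using (⌊_⌋; isYes≗does; does-⇔; dec-false; toWitness; fromWitness; _×-dec_; ¬?)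
open import Relation.Unary using (Pred; Decidable)

open import Algebra.Properties.CommutativeMonoid.Sum +-0-commutativeMonoid
  using (sum; sum-syntax; sum-cong-≗; sum-replicate-zero; ∑-distrib-+; ∑-comm)

open Equivalence using (to; from)

-- Counting subsets of Fin N

∑-const-1 : ∀ N → ∑[ i < N ] 1 ≡ N
∑-const-1 zero    = refl
∑-const-1 (suc N) = cong suc (∑-const-1 N)

∑-mono-≤ : ∀ {N} {f g : Fin N → ℕ} → (∀ i → f i ≤ g i) → sum f ≤ sum g
∑-mono-≤ {zero}  f≤g = z≤n
∑-mono-≤ {suc N} f≤g = +-mono-≤ (f≤g zero) (∑-mono-≤ (λ i → f≤g (suc i)))

∑-↑ : ∀ a b (f : Fin (a + b) → ℕ) →
      sum f ≡ ∑[ i < a ] f (i ↑ˡ b) + ∑[ j < b ] f (a ↑ʳ j)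
∑-↑ zero    b f = refl
∑-↑ (suc a) b f = trans (cong (f zero +_) (∑-↑ a b (λ i → f (suc i))))
                        (sym (+-assoc (f zero) _ _))

∑-combine : ∀ a b (f : Fin (a * b) → ℕ) →
            sum f ≡ ∑[ i < a ] ∑[ j < b ] f (combine i j)
∑-combine zero    b f = refl
∑-combine (suc a) b f = trans (∑-↑ b (a * b) f)
  (cong (∑[ j < b ] f (j ↑ˡ (a * b)) +_) (∑-combine a b (λ k → f (b ↑ʳ k))))

∑>0⇒∃ : ∀ {N} (f : Fin N → ℕ) → 0 < sum f → ∃[ i ] 0 < f i
∑>0⇒∃ {suc N} f ∑f>0 with f zero in eq
... | suc _ = zero , subst (0 <_) (sym eq) z<s
... | zero  with ∑>0⇒∃ (λ i → f (suc i)) ∑f>0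
...   | i , fi>0 = suc i , fi>0

indicator : Bool → ℕ
indicator true  = 1
indicator false = 0

indicator-∨ : ∀ a b → (T a → T b → ⊥) → indicator (a ∨ b) ≡ indicator a + indicator b
indicator-∨ true  true  disjoint = ⊥-elim (disjoint _ _)
indicator-∨ true  false _        = refl
indicator-∨ false b     _        = refl

indicator-split : ∀ a b → indicator a ≡ indicator (a ∧ b) + indicator (a ∧ not b)
indicator-split true  true  = refl
indicator-split true  false = refl
indicator-split false b     = refl

count : ∀ {N} → (Fin N → Bool) → ℕ
count {N} S = ∑[ i < N ] indicator (S i)

⌊⌋-⇔ : ∀ {A B : Set} (a? : Dec A) (b? : Dec B) → A ⇔ B → ⌊ a? ⌋ ≡ ⌊ b? ⌋
⌊⌋-⇔ a? b? A⇔B = trans (isYes≗does a?) (trans (does-⇔ A⇔B a? b?) (sym (isYes≗does b?)))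

singleton : ∀ {N} → Fin N → Fin N → Bool
singleton c i = ⌊ i Fin.≟ c ⌋

infixl 7 _∩_ _∖_

_∩_ _∖_ : ∀ {N} → (Fin N → Bool) → (Fin N → Bool) → Fin N → Bool
(S ∩ Q) i = S i ∧ Q i
(S ∖ Q) i = S i ∧ not (Q i)

∈-∩ : ∀ {N} (S Q : Fin N → Bool) i → T ((S ∩ Q) i) ⇔ (T (S i) × T (Q i))
∈-∩ S Q i = T-∧

∈-∖ : ∀ {N} (S Q : Fin N → Bool) i → T ((S ∖ Q) i) ⇔ (T (S i) × ¬ T (Q i))
∈-∖ S Q i with S i | Q i
... | true  | true  = mk⇔ (λ ()) (λ (_ , Qi∉) → Qi∉ _)
... | true  | false = mk⇔ (λ _ → _ , λ ()) (λ _ → _)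
... | false | _     = mk⇔ (λ ()) proj₁

count-split : ∀ {N} (S Q : Fin N → Bool) → count S ≡ count (S ∩ Q) + count (S ∖ Q)
count-split {N} S Q = trans (sum-cong-≗ {N} (λ i → indicator-split (S i) (Q i)))
  (∑-distrib-+ (λ i → indicator ((S ∩ Q) i)) (λ i → indicator ((S ∖ Q) i)))

≢⇒singleton≡false : ∀ {N} {c i : Fin N} → i ≢ c → singleton c i ≡ false
≢⇒singleton≡false {c = c} {i} i≢c = trans (isYes≗does (i Fin.≟ c)) (dec-false (i Fin.≟ c) i≢c)

count-singleton : ∀ {N} (c : Fin N) → count (singleton c) ≡ 1
count-singleton {suc N} zero = cong suc (trans
  (sum-cong-≗ {N} (λ i → cong indicator (≢⇒singleton≡false {c = zero} {i = suc i} (λ ()))))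
  (sum-replicate-zero N))
count-singleton {suc N} (suc c) = trans
  (cong₂ _+_ (cong indicator (≢⇒singleton≡false {c = suc c} {i = zero} (λ ())))
             (sum-cong-≗ {N} (λ i → cong indicator (singleton-suc i))))
  (count-singleton c)
  where
  singleton-suc : ∀ i → singleton (suc c) (suc i) ≡ singleton c i
  singleton-suc i = trans (isYes≗does (suc i Fin.≟ suc c)) (sym (isYes≗does (i Fin.≟ c)))

count>0⇒∃ : ∀ {N} (S : Fin N → Bool) → 0 < count S → ∃[ i ] T (S i)
count>0⇒∃ S count>0 with ∑>0⇒∃ (λ i → indicator (S i)) count>0
... | i , Si>0 = i , indicator>0 Si>0
  where indicator>0 : ∀ {a} → 0 < indicator a → T a
        indicator>0 {true} _ = _

count-mono : ∀ {N} {S Q : Fin N → Bool} → (∀ i → T (S i) → T (Q i)) → count S ≤ count Q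
count-mono {S = S} {Q} S⊆Q = ∑-mono-≤ (λ i → indicator-mono (S i) (Q i) (S⊆Q i))
  where
  indicator-mono : ∀ a b → (T a → T b) → indicator a ≤ indicator b
  indicator-mono false b     _    = z≤n
  indicator-mono true  true  _    = ≤-refl
  indicator-mono true  false a⇒b  = ⊥-elim (a⇒b _)

∃-another : ∀ {N} (S : Fin N → Bool) {m} → 1 < m → m ∣ count S →
            ∀ {i} → T (S i) → ∃[ j ] (T (S j) × j ≢ i)
∃-another {N} S {m} 1<m m∣count {i} i∈S with count>0⇒∃ (S ∖ singleton i) rest>0
  where
  i⊆S : ∀ j → T (singleton i j) → T (S j)
  i⊆S j j≡i = subst (λ j → T (S j)) (sym (toWitness j≡i)) i∈S
  count≥1 : 1 ≤ count S
  count≥1 = subst (_≤ count S) (count-singleton i) (count-mono i⊆S)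
  S∩i≤1 : count (S ∩ singleton i) ≤ 1
  S∩i≤1 = subst (count (S ∩ singleton i) ≤_) (count-singleton i)
                  (count-mono (λ j j∈ → proj₂ (to (∈-∩ S (singleton i) j) j∈)))
  rest>0 : 0 < count (S ∖ singleton i)
  rest>0 = s≤s⁻¹ (begin
    2                                                  ≤⟨ 1<m ⟩
    m                                                  ≤⟨ ∣⇒≤ {{>-nonZero count≥1}} m∣count ⟩
    count S                                            ≡⟨ count-split S (singleton i) ⟩
    count (S ∩ singleton i) + count (S ∖ singleton i)  ≤⟨ +-monoˡ-≤ _ S∩i≤1 ⟩
    1 + count (S ∖ singleton i)                        ∎)
    where open ≤-Reasoning
... | j , j∈ with to (∈-∖ S (singleton i) j) j∈
...   | j∈S , j≢i = j , j∈S , λ j≡i → j≢i (fromWitness j≡i)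

-- Periodic maps

module PeriodicMap {N} (σ : Fin N → Fin N) (k : ℕ) .{{_ : NonZero k}}
                   (periodic : ∀ i → fold i σ k ≡ i) where

  σ-injective : ∀ {a b} → σ a ≡ σ b → a ≡ b
  σ-injective {a} {b} σa≡σb = begin
    a                       ≡⟨ periodic a ⟨
    fold a σ k              ≡⟨ cong (fold a σ) k≡pred+1 ⟩
    fold a σ (pred k + 1)   ≡⟨ fold-+ a σ (pred k) ⟩
    fold (σ a) σ (pred k)   ≡⟨ cong (λ z → fold z σ (pred k)) σa≡σb ⟩
    fold (σ b) σ (pred k)   ≡⟨ fold-+ b σ (pred k) ⟨
    fold b σ (pred k + 1)   ≡⟨ cong (fold b σ) k≡pred+1 ⟨
    fold b σ k              ≡⟨ periodic b ⟩
    b                       ∎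
    where
    open ≡-Reasoning
    k≡pred+1 : k ≡ pred k + 1
    k≡pred+1 = trans (sym (suc-pred k)) (+-comm 1 (pred k))

  Closed : (Fin N → Bool) → Set
  Closed S = ∀ i → T (S i) → T (S (σ i))

  Free : (Fin N → Bool) → Set
  Free S = ∀ i → T (S i) → ∀ j → 0 < j → j < k → fold i σ j ≢ i

  closed-fold : ∀ {S} → Closed S → ∀ j i → T (S i) → T (S (fold i σ j))
  closed-fold closed zero    i Si = Si
  closed-fold closed (suc j) i Si = closed _ (closed-fold closed j i Si)

  orbitPrefix : Fin N → ℕ → Fin N → Bool
  orbitPrefix g zero    h = false
  orbitPrefix g (suc m) h = orbitPrefix g m h ∨ singleton (fold g σ m) h

  orbitPrefix-sound : ∀ g m h → T (orbitPrefix g m h) → ∃[ j ] j < m × h ≡ fold g σ j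
  orbitPrefix-sound g (suc m) h h∈ with to (T-∨ {orbitPrefix g m h}) h∈
  ... | inj₁ h∈prefix = let j , j<m , h≡ = orbitPrefix-sound g m h h∈prefix in
                        j , m<n⇒m<1+n j<m , h≡
  ... | inj₂ h≡σ^mg   = m , ≤-refl , toWitness h≡σ^mg

  orbitPrefix-complete : ∀ g m j → j < m → T (orbitPrefix g m (fold g σ j))
  orbitPrefix-complete g (suc m) j j<1+m with m≤n⇒m<n∨m≡n (s≤s⁻¹ j<1+m)
  ... | inj₁ j<m  = from (T-∨ {orbitPrefix g m (fold g σ j)}) (inj₁ (orbitPrefix-complete g m j j<m))
  ... | inj₂ refl = from (T-∨ {orbitPrefix g m (fold g σ m)}) (inj₂ (fromWitness refl))

  orbit : Fin N → Fin N → Bool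
  orbit g = orbitPrefix g k

  orbit-σ⁻¹ : ∀ g i → T (orbit g (σ i)) → T (orbit g i)
  orbit-σ⁻¹ g i σi∈orbit with orbitPrefix-sound g k (σ i) σi∈orbit
  ... | zero  , _   , σi≡g    = subst (λ h → T (orbit g h)) (sym (σ-injective (trans σi≡g (sym σᵏg≡g))))
                                  (orbitPrefix-complete g k (pred k) (m≤pred[n]⇒suc[m]≤n ≤-refl))
    where σᵏg≡g : σ (fold g σ (pred k)) ≡ g
          σᵏg≡g = subst (λ t → fold g σ t ≡ g) (sym (suc-pred k)) (periodic g)
  ... | suc j , j<k , σi≡σσʲg = subst (λ h → T (orbit g h)) (sym (σ-injective σi≡σσʲg))
                                  (orbitPrefix-complete g k j (<⇒≤ j<k))

  module _ {S : Fin N → Bool} (closed : Closed S) (free : Free S) {g : Fin N} (g∈S : T (S g)) where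

    orbit-injective : ∀ {i j} → i < j → j < k → fold g σ i ≢ fold g σ j
    orbit-injective {i} {j} i<j j<k σⁱg≡σʲg =
      free σⁱg (closed-fold closed i g g∈S) (j ∸ i) (m<n⇒0<n∸m i<j) (≤-<-trans (m∸n≤m j i) j<k) (begin
        fold σⁱg σ (j ∸ i)     ≡⟨ fold-+ g σ (j ∸ i) ⟨
        fold g σ (j ∸ i + i)   ≡⟨ cong (fold g σ) (m∸n+n≡m (<⇒≤ i<j)) ⟩
        fold g σ j             ≡⟨ σⁱg≡σʲg ⟨
        σⁱg                    ∎)
      where
      open ≡-Reasoning
      σⁱg = fold g σ i

    count-orbitPrefix : ∀ m → m ≤ k → count (orbitPrefix g m) ≡ m
    count-orbitPrefix zero    _   = sum-replicate-zero N
    count-orbitPrefix (suc m) m<k = begin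
      count (orbitPrefix g (suc m))
        ≡⟨ sum-cong-≗ {N} (λ h → indicator-∨ (orbitPrefix g m h) _ (disjoint h)) ⟩
      ∑[ h < N ] (indicator (orbitPrefix g m h) + indicator (singleton (fold g σ m) h))
        ≡⟨ ∑-distrib-+ (λ h → indicator (orbitPrefix g m h)) _ ⟩
      count (orbitPrefix g m) + count (singleton (fold g σ m))
        ≡⟨ cong₂ _+_ (count-orbitPrefix m (<⇒≤ m<k)) (count-singleton (fold g σ m)) ⟩
      m + 1
        ≡⟨ +-comm m 1 ⟩
      suc m ∎
      where
      open ≡-Reasoning
      disjoint : ∀ h → T (orbitPrefix g m h) → T (singleton (fold g σ m) h) → ⊥
      disjoint h h∈prefix h≡σᵐg with orbitPrefix-sound g m h h∈prefix
      ... | j , j<m , refl = orbit-injective j<m m<k (toWitness h≡σᵐg)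

    orbit⊆S : ∀ h → T (orbit g h) → T (S h)
    orbit⊆S h h∈orbit with orbitPrefix-sound g k h h∈orbit
    ... | j , _ , refl = closed-fold closed j g g∈S

    closed-S∖orbit : Closed (S ∖ orbit g)
    closed-S∖orbit i i∈ with to (∈-∖ S (orbit g) i) i∈
    ... | i∈S , i∉orbit = from (∈-∖ S (orbit g) (σ i))
                            (closed i i∈S , λ σi∈orbit → i∉orbit (orbit-σ⁻¹ g i σi∈orbit))

    free-S∖orbit : Free (S ∖ orbit g)
    free-S∖orbit i i∈ = free i (proj₁ (to (∈-∖ S (orbit g) i) i∈))

    count-without-orbit : count S ≡ count (S ∖ orbit g) + k
    count-without-orbit = begin
      count S                                    ≡⟨ count-split S (orbit g) ⟩
      count (S ∩ orbit g) + count (S ∖ orbit g)  ≡⟨ +-comm _ (count (S ∖ orbit g)) ⟩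
      count (S ∖ orbit g) + count (S ∩ orbit g)  ≡⟨ cong (count (S ∖ orbit g) +_) S∩orbit ⟩
      count (S ∖ orbit g) + k                    ∎
      where
      open ≡-Reasoning
      S∩orbit≡orbit : ∀ i → S i ∧ orbit g i ≡ orbit g i
      S∩orbit≡orbit i with orbit g i in eq
      ... | false = ∧-zeroʳ (S i)
      ... | true  = trans (∧-identityʳ (S i)) (to T-≡ (orbit⊆S i (subst T (sym eq) _)))
      S∩orbit : count (S ∩ orbit g) ≡ k
      S∩orbit = trans (sum-cong-≗ {N} (λ i → cong indicator (S∩orbit≡orbit i)))
                      (count-orbitPrefix k ≤-refl)

  k∣count : ∀ S → Closed S → Free S → k ∣ count S
  k∣count S = <-rec Goal step (count S) S refl
    where
    Goal : ℕ → Set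
    Goal c = ∀ S → count S ≡ c → Closed S → Free S → k ∣ c
    step : ∀ c → (∀ {c'} → c' < c → Goal c') → Goal c
    step zero    _   _ _         _      _    = k ∣0
    step (suc c) rec S count≡1+c closed free with count>0⇒∃ S (subst (0 <_) (sym count≡1+c) z<s)
    ... | g , g∈S = subst (k ∣_) count≡ (∣m∣n⇒∣m+n k∣rest ∣-refl)
      where
      count≡ : count (S ∖ orbit g) + k ≡ suc c
      count≡ = trans (sym (count-without-orbit closed free g∈S)) count≡1+c
      k∣rest : k ∣ count (S ∖ orbit g)
      k∣rest = rec (subst (count (S ∖ orbit g) <_) count≡ (m<m+n _ (>-nonZero⁻¹ k)))
                   (S ∖ orbit g) refl (closed-S∖orbit closed free g∈S) (free-S∖orbit closed free g∈S)

-- Arithmetic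

least : {P : Pred ℕ 0ℓ} → Decidable P → ∀ {m} → P m → ∃[ k ] (P k × ∀ {j} → j < k → ¬ P j)
least {P} P? {m} = <-rec (λ m → P m → ∃[ k ] (P k × ∀ {j} → j < k → ¬ P j)) step m
  where
  step : ∀ m → (∀ {j} → j < m → P j → ∃[ k ] (P k × ∀ {i} → i < k → ¬ P i)) →
         P m → ∃[ k ] (P k × ∀ {j} → j < k → ¬ P j)
  step m below Pm with anyUpTo? P? m
  ... | yes (j , j<m , Pj) = below j<m Pj
  ... | no  none           = m , Pm , λ j<m Pj → none (_ , j<m , Pj)

period-multiple : ∀ {A : Set} (u : ℕ → A) {m} →
                  (∀ k → u (k + m) ≡ u k) → ∀ c k → u (k + c * m) ≡ u k
period-multiple u             period zero    k = cong u (+-identityʳ k)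
period-multiple u {m} period (suc c) k = begin
  u (k + (m + c * m))  ≡⟨ cong u (trans (cong (k +_) (+-comm m (c * m))) (sym (+-assoc k (c * m) m))) ⟩
  u (k + c * m + m)    ≡⟨ period (k + c * m) ⟩
  u (k + c * m)        ≡⟨ period-multiple u period c k ⟩
  u k                  ∎
  where open ≡-Reasoning

coprime-periods⇒constant : ∀ {A : Set} (u : ℕ → A) {m p} → Coprime m p →
  (∀ k → u (k + m) ≡ u k) → (∀ k → u (k + p) ≡ u k) → ∀ k → u (suc k) ≡ u k
coprime-periods⇒constant u {m} {p} m⊥p period-m period-p k with coprime-Bézout m⊥p
... | Bézout.+- x y 1+yp≡xm = begin
  u (suc k)            ≡⟨ period-multiple u period-p y (suc k) ⟨
  u (suc k + y * p)    ≡⟨ cong u (trans (sym (+-suc k (y * p))) (cong (k +_) 1+yp≡xm)) ⟩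
  u (k + x * m)        ≡⟨ period-multiple u period-m x k ⟩
  u k                  ∎
  where open ≡-Reasoning
... | Bézout.-+ x y 1+xm≡yp = begin
  u (suc k)            ≡⟨ period-multiple u period-m x (suc k) ⟨
  u (suc k + x * m)    ≡⟨ cong u (trans (sym (+-suc k (x * m))) (cong (k +_) 1+xm≡yp)) ⟩
  u (k + y * p)        ≡⟨ period-multiple u period-p y k ⟩
  u k                  ∎
  where open ≡-Reasoning

prime>1 : ∀ {p} → Prime p → 1 < p
prime>1 {p} p-prime = nonTrivial⇒n>1 p {{prime⇒nonTrivial p-prime}}

prime∣prime⇒≡ : ∀ {p q} → Prime p → Prime q → p ∣ q → p ≡ q
prime∣prime⇒≡ p-prime q-prime p∣q with prime⇒irreducible q-prime p∣q
... | inj₁ refl = ⊥-elim (<-irrefl refl (prime>1 p-prime))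
... | inj₂ p≡q  = p≡q

prime∤1 : ∀ {p} → Prime p → ¬ p ∣ 1
prime∤1 p-prime p∣1 = <-irrefl (sym (∣1⇒≡1 p∣1)) (prime>1 p-prime)

prime∤product : ∀ {r p q} → Prime r → Prime p → Prime q → r ≢ p → r ≢ q → ¬ r ∣ p * q
prime∤product {r} {p} {q} r-prime p-prime q-prime r≢p r≢q r∣pq with euclidsLemma p q r-prime r∣pq
... | inj₁ r∣p = r≢p (prime∣prime⇒≡ r-prime p-prime r∣p)
... | inj₂ r∣q = r≢q (prime∣prime⇒≡ r-prime q-prime r∣q)

primes⇒product∣ : ∀ {p q m} → Prime p → Prime q → p ≢ q → p ∣ m → q ∣ m → p * q ∣ m
primes⇒product∣ {p} {q} p-prime q-prime p≢q p∣m (divides c refl) with euclidsLemma c q p-prime p∣m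
... | inj₂ p∣q = ⊥-elim (p≢q (prime∣prime⇒≡ p-prime q-prime p∣q))
... | inj₁ (divides c′ refl) = divides c′ (*-assoc c′ p q)

¬m*n∣m : ∀ {m n} .{{_ : NonZero m}} → Prime n → ¬ m * n ∣ m
¬m*n∣m {m} n-prime mn∣m = prime∤1 n-prime (*-cancelˡ-∣ m (subst (m * _ ∣_) (sym (*-identityʳ m)) mn∣m))

¬m*n∣n : ∀ {m n} .{{_ : NonZero n}} → Prime m → ¬ m * n ∣ n
¬m*n∣n {m} {n} m-prime = subst (λ k → ¬ k ∣ n) (*-comm n m) (¬m*n∣m m-prime)

2<p*q : ∀ {p q} → Prime p → 2 < q → 2 < p * q
2<p*q {p} {q} p-prime 2<q = <-≤-trans 2<q (m≤n*m q p {{prime⇒nonZero p-prime}})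

¬p*p∣p*q : ∀ {p q} → Prime p → Prime q → p ≢ q → ¬ p * p ∣ p * q
¬p*p∣p*q {p} p-prime q-prime p≢q pp∣pq =
  p≢q (prime∣prime⇒≡ p-prime q-prime (*-cancelˡ-∣ p {{prime⇒nonZero p-prime}} pp∣pq))

Incomparable : ℕ → ℕ → Set
Incomparable a b = ¬ a ∣ b × ¬ b ∣ a

incomparable-by-witnesses : ∀ {a b t u} → t ∣ a → ¬ t ∣ b → u ∣ b → ¬ u ∣ a → Incomparable a b
incomparable-by-witnesses t∣a t∤b u∣b u∤a =
  (λ a∣b → t∤b (∣-trans t∣a a∣b)) , (λ b∣a → u∤a (∣-trans u∣b b∣a))

distinct-primes-incomparable : ∀ {p q} → Prime p → Prime q → p ≢ q → Incomparable p q
distinct-primes-incomparable p-prime q-prime p≢q =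
  (λ p∣q → p≢q (prime∣prime⇒≡ p-prime q-prime p∣q)) ,
  (λ q∣p → p≢q (sym (prime∣prime⇒≡ q-prime p-prime q∣p)))

∃-prime-factor : ∀ {m} → 1 < m → ∃[ r ] (Prime r × r ∣ m)
∃-prime-factor {m@(suc _)} 1<m with factorise m
... | record { factors = []     ; isFactorisation = m≡1 } = ⊥-elim (<-irrefl (sym m≡1) 1<m)
... | record { factors = r ∷ rs ; isFactorisation = m≡r*rs ; factorsPrime = r-prime ∷ _ } =
  r , r-prime , divides (List.product rs) (trans m≡r*rs (*-comm r (List.product rs)))

prime-power-or-other-prime : ∀ {p} → Prime p → ∀ m → 0 < m →
  (∃[ k ] m ≡ p ^ k) ⊎ (∃[ q ] (Prime q × q ≢ p × q ∣ m))
prime-power-or-other-prime {p} p-prime = <-rec Goal step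
  where
  Goal : ℕ → Set
  Goal m = 0 < m → (∃[ k ] m ≡ p ^ k) ⊎ (∃[ q ] (Prime q × q ≢ p × q ∣ m))
  step : ∀ m → (∀ {m′} → m′ < m → Goal m′) → Goal m
  step (suc zero) _ _ = inj₁ (0 , refl)
  step m@(suc (suc _)) below _ with p ∣? m
  ... | no p∤m with ∃-prime-factor {m} (s≤s (s≤s z≤n))
  ...   | r , r-prime , r∣m = inj₂ (r , r-prime , (λ { refl → p∤m r∣m }) , r∣m)
  step m@(suc (suc _)) below _ | yes (divides c m≡c*p) with below c<m c>0
    where
    c>0 : 0 < c
    c>0 = n≢0⇒n>0 λ { refl → 0≢1+n (sym m≡c*p) }
    c<m : c < m
    c<m = subst (c <_) (sym m≡c*p) (m<m*n c p {{>-nonZero c>0}} (prime>1 p-prime))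
  ... | inj₁ (k , refl) = inj₁ (suc k , trans m≡c*p (*-comm (p ^ k) p))
  ... | inj₂ (q , q-prime , q≢p , q∣c) =
    inj₂ (q , q-prime , q≢p , ∣-trans q∣c (divides p (trans m≡c*p (*-comm c p))))

two-primes-or-third : ∀ m → 0 < m → ∀ p q →
  (∀ r → Prime r → r ∣ m → r ≡ p ⊎ r ≡ q) ⊎ (∃[ r ] (Prime r × r ≢ p × r ≢ q × r ∣ m))
two-primes-or-third m m>0 p q
  with anyUpTo? (λ r → prime? r ×-dec ¬? (r ≟ p) ×-dec ¬? (r ≟ q) ×-dec r ∣? m) (suc m)
... | yes (r , _ , third) = inj₂ (r , third)
... | no  no-third        = inj₁ only-p-q
  where
  only-p-q : ∀ r → Prime r → r ∣ m → r ≡ p ⊎ r ≡ q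
  only-p-q r r-prime r∣m with r ≟ p | r ≟ q
  ... | yes r≡p | _       = inj₁ r≡p
  ... | no  _   | yes r≡q = inj₂ r≡q
  ... | no  r≢p | no  r≢q =
    ⊥-elim (no-third (r , s≤s (∣⇒≤ {{>-nonZero m>0}} r∣m) , r-prime , r≢p , r≢q , r∣m))

∣p^k⇒≡p^i : ∀ {p} → Prime p → ∀ k {d} → d ∣ p ^ k → ∃[ i ] d ≡ p ^ i
∣p^k⇒≡p^i p-prime zero    d∣1 = 0 , ∣1⇒≡1 d∣1
∣p^k⇒≡p^i {p} p-prime (suc k) {d} d∣p^[1+k] with p ∣? d
... | yes (divides d′ refl) with ∣p^k⇒≡p^i p-prime k {d′}
       (*-cancelˡ-∣ p {{prime⇒nonZero p-prime}} (subst (_∣ p * p ^ k) (*-comm d′ p) d∣p^[1+k]))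
...   | i , refl = suc i , *-comm (p ^ i) p
∣p^k⇒≡p^i {p} p-prime (suc k) {d} d∣p^[1+k] | no p∤d =
  ∣p^k⇒≡p^i p-prime k (Coprimality.coprime-divisor d⊥p d∣p^[1+k])
  where
  d⊥p : Coprimality.Coprime d p
  d⊥p (c∣d , c∣p) with prime⇒irreducible p-prime c∣p
  ... | inj₁ c≡1  = c≡1
  ... | inj₂ refl = ⊥-elim (p∤d c∣d)

divisors-of-prime-power-comparable : ∀ {p} → Prime p → ∀ k {a b} →
                                     a ∣ p ^ k → b ∣ p ^ k → a ∣ b ⊎ b ∣ a
divisors-of-prime-power-comparable {p} p-prime k a∣p^k b∣p^k
  with ∣p^k⇒≡p^i p-prime k a∣p^k | ∣p^k⇒≡p^i p-prime k b∣p^k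
... | i , refl | j , refl = Sum.map p^-mono-∣ p^-mono-∣ (≤-total i j)
  where
  p^-mono-∣ : ∀ {i j} → i ≤ j → p ^ i ∣ p ^ j
  p^-mono-∣ {i} {j} i≤j =
    divides (p ^ (j ∸ i)) (trans (cong (p ^_) (sym (m∸n+n≡m i≤j))) (^-distribˡ-+-* p (j ∸ i) i))

squarefree⇒∣ : ∀ {m K} → 0 < m → (∀ r → Prime r → ¬ r * r ∣ m) →
               (∀ r → Prime r → r ∣ m → r ∣ K) → m ∣ K
squarefree⇒∣ {m} {K} = <-rec Goal step m
  where
  Goal : ℕ → Set
  Goal m = 0 < m → (∀ r → Prime r → ¬ r * r ∣ m) → (∀ r → Prime r → r ∣ m → r ∣ K) → m ∣ K
  step : ∀ m → (∀ {m′} → m′ < m → Goal m′) → Goal m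
  step (suc zero) _ _ _ _ = 1∣ K
  step m@(suc (suc _)) below _ squarefree primes∣K with ∃-prime-factor {m} (s≤s (s≤s z≤n))
  ... | r , r-prime , divides c m≡c*r = subst (_∣ K) (sym m≡c*r) c*r∣K
    where
    c>0 : 0 < c
    c>0 = n≢0⇒n>0 λ { refl → 0≢1+n (sym m≡c*r) }
    c∣m : c ∣ m
    c∣m = divides r (trans m≡c*r (*-comm c r))
    c∣K : c ∣ K
    c∣K = below (subst (c <_) (sym m≡c*r) (m<m*n c r {{>-nonZero c>0}} (prime>1 r-prime))) c>0
            (λ s s-prime ss∣c → squarefree s s-prime (∣-trans ss∣c c∣m))
            (λ s s-prime s∣c → primes∣K s s-prime (∣-trans s∣c c∣m))
    c*r∣K : c * r ∣ K
    c*r∣K with c∣K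
    ... | divides d refl with euclidsLemma d c r-prime (primes∣K r r-prime (divides c m≡c*r))
    ...   | inj₂ r∣c = ⊥-elim (squarefree r r-prime (subst (r * r ∣_) (sym m≡c*r) (*-monoˡ-∣ r r∣c)))
    ...   | inj₁ (divides d′ refl) = divides d′ (trans (*-assoc d′ r c) (cong (d′ *_) (*-comm r c)))

-- Orders of elements of a finite group

module GroupTheory (G : FiniteGroup) where
  open FiniteGroup G
  open IsGroup isGroup using (assoc; identityˡ; identityʳ; inverseˡ; inverseʳ)

  asGroup : Group 0ℓ 0ℓ
  asGroup = record { Carrier = Fin n ; _≈_ = _≡_ ; _∙_ = _∙_ ; ε = e ; _⁻¹ = _⁻¹ ; isGroup = isGroup }

  open GroupProperties asGroup using (identityˡ-unique; identityʳ-unique; inverseˡ-unique)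

  pow-+ : ∀ x a b → pow G x (a + b) ≡ pow G x a ∙ pow G x b
  pow-+ x zero    b = sym (identityˡ _)
  pow-+ x (suc a) b = trans (cong (x ∙_) (pow-+ x a b)) (sym (assoc _ _ _))

  pow-* : ∀ x a b → pow G (pow G x a) b ≡ pow G x (b * a)
  pow-* x a zero    = refl
  pow-* x a (suc b) = trans (cong (pow G x a ∙_) (pow-* x a b)) (sym (pow-+ x a (b * a)))

  pow-e : ∀ b → pow G e b ≡ e
  pow-e zero    = refl
  pow-e (suc b) = trans (identityˡ _) (pow-e b)

  pow-1 : ∀ x → pow G x 1 ≡ x
  pow-1 = identityʳ

  pow-suc-∙ : ∀ x j → pow G x (suc j) ≡ pow G x j ∙ x
  pow-suc-∙ x j = begin
    pow G x (suc j)        ≡⟨ cong (pow G x) (+-comm 1 j) ⟩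
    pow G x (j + 1)        ≡⟨ pow-+ x j 1 ⟩
    pow G x j ∙ pow G x 1  ≡⟨ cong (pow G x j ∙_) (pow-1 x) ⟩
    pow G x j ∙ x          ∎
    where open ≡-Reasoning

  pow-⁻¹-∙-pow : ∀ x j → pow G (x ⁻¹) j ∙ pow G x j ≡ e
  pow-⁻¹-∙-pow x zero    = identityˡ e
  pow-⁻¹-∙-pow x (suc j) = begin
    ((x ⁻¹) ∙ y) ∙ pow G x (suc j)   ≡⟨ cong (((x ⁻¹) ∙ y) ∙_) (pow-suc-∙ x j) ⟩
    ((x ⁻¹) ∙ y) ∙ (z ∙ x)           ≡⟨ assoc _ _ _ ⟩
    (x ⁻¹) ∙ (y ∙ (z ∙ x))           ≡⟨ cong ((x ⁻¹) ∙_) (assoc _ _ _) ⟨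
    (x ⁻¹) ∙ ((y ∙ z) ∙ x)           ≡⟨ cong (λ w → (x ⁻¹) ∙ (w ∙ x)) (pow-⁻¹-∙-pow x j) ⟩
    (x ⁻¹) ∙ (e ∙ x)                 ≡⟨ cong ((x ⁻¹) ∙_) (identityˡ x) ⟩
    (x ⁻¹) ∙ x                       ≡⟨ inverseˡ x ⟩
    e                                ∎
    where
    open ≡-Reasoning
    y = pow G (x ⁻¹) j
    z = pow G x j

  ∙≡e⇒[≡e⇔≡e] : ∀ {a b} → a ∙ b ≡ e → (a ≡ e ⇔ b ≡ e)
  ∙≡e⇒[≡e⇔≡e] {a} {b} ab≡e = mk⇔
    (λ { refl → trans (sym (identityˡ b)) ab≡e })
    (λ { refl → trans (sym (identityʳ a)) ab≡e })

  ∙≡e⇒∙-comm : ∀ {a b} → a ∙ b ≡ e → b ∙ a ≡ e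
  ∙≡e⇒∙-comm {a} {b} ab≡e = trans (cong (b ∙_) (inverseˡ-unique a b ab≡e)) (inverseʳ b)

  pow-⁻¹≡e⇔pow≡e : ∀ x j → pow G (x ⁻¹) j ≡ e ⇔ pow G x j ≡ e
  pow-⁻¹≡e⇔pow≡e x j = ∙≡e⇒[≡e⇔≡e] (pow-⁻¹-∙-pow x j)

  PositivePowerIsE : Fin n → Pred ℕ 0ℓ
  PositivePowerIsE x j = 0 < j × pow G x j ≡ e

  positivePowerIsE? : ∀ x → Decidable (PositivePowerIsE x)
  positivePowerIsE? x zero    = no λ ()
  positivePowerIsE? x (suc j) with pow G x (suc j) Fin.≟ e
  ... | yes xʲ≡e = yes (z<s , xʲ≡e)
  ... | no  xʲ≢e = no λ (_ , xʲ≡e) → xʲ≢e xʲ≡e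

  positivePowerIsE : ∀ x → ∃[ K ] PositivePowerIsE x K
  positivePowerIsE x with pigeonhole (n<1+n n) (λ i → pow G x (toℕ i))
  ... | i , j , i<j , xⁱ≡xʲ =
    toℕ j ∸ toℕ i , m<n⇒0<n∸m i<j , identityˡ-unique _ (pow G x (toℕ i)) (begin
    pow G x (toℕ j ∸ toℕ i) ∙ pow G x (toℕ i)  ≡⟨ pow-+ x (toℕ j ∸ toℕ i) (toℕ i) ⟨
    pow G x (toℕ j ∸ toℕ i + toℕ i)            ≡⟨ cong (pow G x) (m∸n+n≡m (<⇒≤ i<j)) ⟩
    pow G x (toℕ j)                            ≡⟨ xⁱ≡xʲ ⟨
    pow G x (toℕ i)                            ∎)
    where open ≡-Reasoning

  -- Opaque: only its specification IsOrder is used, and unfolding the search is very costly.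
  opaque
   order : ∀ x → ∃[ k ] IsOrder G x k
   order x with least (positivePowerIsE? x) (proj₂ (positivePowerIsE x))
   ... | k , (k>0 , xᵏ≡e) , minimal = k , k>0 , xᵏ≡e , λ j j>0 j<k xʲ≡e → minimal j<k (j>0 , xʲ≡e)

  order-unique : ∀ {x a b} → IsOrder G x a → IsOrder G x b → a ≡ b
  order-unique {x} {a} {b} (a>0 , xᵃ≡e , a-min) (b>0 , xᵇ≡e , b-min) with <-cmp a b
  ... | tri< a<b _ _ = ⊥-elim (b-min a a>0 a<b xᵃ≡e)
  ... | tri≈ _ a≡b _ = a≡b
  ... | tri> _ _ b<a = ⊥-elim (a-min b b>0 b<a xᵇ≡e)

  order-≢⇒≢ : ∀ {x y a b} → IsOrder G x a → IsOrder G y b → a ≢ b → x ≢ y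
  order-≢⇒≢ oa ob a≢b refl = a≢b (order-unique oa ob)

  pow≡e⇒order∣ : ∀ {x k m} → IsOrder G x k → pow G x m ≡ e → k ∣ m
  pow≡e⇒order∣ {x} {k@(suc _)} {m} (_ , xᵏ≡e , k-min) xᵐ≡e = m%n≡0⇒n∣m m k m%k≡0
    where
    x^[m%k]≡e : pow G x (m % k) ≡ e
    x^[m%k]≡e = identityˡ-unique _ (pow G x ((m / k) * k)) (begin
      pow G x (m % k) ∙ pow G x ((m / k) * k)  ≡⟨ pow-+ x (m % k) ((m / k) * k) ⟨
      pow G x (m % k + (m / k) * k)            ≡⟨ cong (pow G x) (m≡m%n+[m/n]*n m k) ⟨
      pow G x m                                ≡⟨ xᵐ≡e ⟩
      e                                        ≡⟨ pow-e (m / k) ⟨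
      pow G e (m / k)                          ≡⟨ cong (λ z → pow G z (m / k)) xᵏ≡e ⟨
      pow G (pow G x k) (m / k)                ≡⟨ pow-* x k (m / k) ⟩
      pow G x ((m / k) * k)                    ∎)
      where open ≡-Reasoning
    m%k≡0 : m % k ≡ 0
    m%k≡0 with m % k in eq
    ... | zero  = refl
    ... | suc r = ⊥-elim (k-min (suc r) z<s (subst (_< k) eq (m%n<n m k))
                                            (subst (λ j → pow G x j ≡ e) eq x^[m%k]≡e))

  order-pow : ∀ {x} a b → IsOrder G x (a * b) → IsOrder G (pow G x a) b
  order-pow a zero (ab>0 , _) = ⊥-elim (<-irrefl (sym (*-zeroʳ a)) ab>0)
  order-pow {x} a@(suc _) b@(suc _) (_ , xᵃᵇ≡e , ab-min) =
    z<s ,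
    trans (pow-* x a b) (trans (cong (pow G x) (*-comm b a)) xᵃᵇ≡e) ,
    λ j j>0 j<b xᵃʲ≡e → ab-min (j * a) (*-monoˡ-< a j>0)
                          (subst (j * a <_) (*-comm b a) (*-monoˡ-< a j<b)) (trans (sym (pow-* x a j)) xᵃʲ≡e)

  order-⁻¹ : ∀ {x k} → IsOrder G x k → IsOrder G (x ⁻¹) k
  order-⁻¹ {x} {k} (k>0 , xᵏ≡e , k-min) =
    k>0 , from (pow-⁻¹≡e⇔pow≡e x k) xᵏ≡e ,
    λ j j>0 j<k x⁻ʲ≡e → k-min j j>0 j<k (to (pow-⁻¹≡e⇔pow≡e x j) x⁻ʲ≡e)

  order>2⇒⁻¹≢ : ∀ {x k} → IsOrder G x k → 2 < k → x ⁻¹ ≢ x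
  order>2⇒⁻¹≢ {x} (_ , _ , k-min) 2<k x⁻¹≡x = k-min 2 z<s 2<k (begin
    x ∙ pow G x 1  ≡⟨ cong (x ∙_) (pow-1 x) ⟩
    x ∙ x          ≡⟨ cong (_∙ x) x⁻¹≡x ⟨
    (x ⁻¹) ∙ x     ≡⟨ inverseˡ x ⟩
    e              ∎)
    where open ≡-Reasoning

  order≡1⇒≡e : ∀ {x} → IsOrder G x 1 → x ≡ e
  order≡1⇒≡e {x} (_ , x¹≡e , _) = trans (sym (pow-1 x)) x¹≡e

  order∣|G| : ∀ {x k} → IsOrder G x k → k ∣ n
  order∣|G| {x} {k@(suc _)} (_ , xᵏ≡e , k-min) =
    subst (k ∣_) (∑-const-1 n) (k∣count (λ _ → true) (λ _ _ → _) free)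
    where
    σ : Fin n → Fin n
    σ h = h ∙ x
    fold≡∙pow : ∀ j h → fold h σ j ≡ h ∙ pow G x j
    fold≡∙pow zero    h = sym (identityʳ h)
    fold≡∙pow (suc j) h = trans (cong (_∙ x) (fold≡∙pow j h))
                            (trans (assoc _ _ _) (cong (h ∙_) (sym (pow-suc-∙ x j))))
    periodic : ∀ h → fold h σ k ≡ h
    periodic h = trans (fold≡∙pow k h) (trans (cong (h ∙_) xᵏ≡e) (identityʳ h))
    open PeriodicMap σ k periodic using (Free; k∣count)
    free : Free (λ _ → true)
    free h _ j j>0 j<k σʲh≡h = k-min j j>0 j<k (identityʳ-unique h _ (trans (sym (fold≡∙pow j h)) σʲh≡h))

  prime-order : ∀ {g p} → Prime p → g ≢ e → pow G g p ≡ e → IsOrder G g p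
  prime-order {g} p-prime g≢e gᵖ≡e with order g
  ... | k , order-k with prime⇒irreducible p-prime (pow≡e⇒order∣ order-k gᵖ≡e)
  ...   | inj₁ refl = ⊥-elim (g≢e (order≡1⇒≡e order-k))
  ...   | inj₂ refl = order-k

-- Cauchy's theorem

funToFin-cong : ∀ {m k} {f g : Fin m → Fin k} → (∀ j → f j ≡ g j) → funToFin f ≡ funToFin g
funToFin-cong {zero}  f≗g = refl
funToFin-cong {suc m} f≗g = cong₂ combine (f≗g zero) (funToFin-cong (λ j → f≗g (suc j)))

module Cauchy (G : FiniteGroup) where
  open FiniteGroup G
  open IsGroup isGroup using (inverseˡ)
  open GroupTheory G
  open GroupProperties asGroup using (inverseˡ-unique)
  open MonoidSum (Group.monoid asGroup) using ()
    renaming (sum to ∏; sum-cong-≗ to ∏-cong; sum-replicate-zero to ∏-e; sum-init-last to ∏-init-last)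

  ∏ℕ : (ℕ → Fin n) → ℕ → Fin n
  ∏ℕ w L = ∏ {L} (λ j → w (toℕ j))

  ∏ℕ-cong : ∀ {v w} L → (∀ k → v k ≡ w k) → ∏ℕ v L ≡ ∏ℕ w L
  ∏ℕ-cong L v≗w = ∏-cong {L} (λ j → v≗w (toℕ j))

  ∏ℕ-snoc : ∀ w L → ∏ℕ w (suc L) ≡ ∏ℕ w L ∙ w L
  ∏ℕ-snoc w L = trans (∏-init-last (λ j → w (toℕ j)))
    (cong₂ _∙_ (∏-cong {L} (λ j → cong w (toℕ-inject₁ j))) (cong w (toℕ-fromℕ L)))

  ∏-const : ∀ L c → ∏ {L} (λ _ → c) ≡ pow G c L
  ∏-const zero    c = refl
  ∏-const (suc L) c = cong (c ∙_) (∏-const L c)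

  module McKay (q : ℕ) (p-prime : Prime (suc q)) where
    p = suc q

    -- A p-tuple (g₀, …, g_{p-1}) ∈ Gᵖ, encoded by funToFin; entry t k is g_{k mod p}.
    Tuple : Set
    Tuple = Fin (n ^ p)

    entry : Tuple → ℕ → Fin n
    entry t k = finToFun t (k mod p)

    mod-cong : ∀ {k l} → k % p ≡ l % p → k mod p ≡ l mod p
    mod-cong {k} {l} k≡l = toℕ-injective (trans (toℕ-fromℕ< _) (trans k≡l (sym (toℕ-fromℕ< _))))

    entry-toℕ : ∀ t (j : Fin p) → entry t (toℕ j) ≡ finToFun t j
    entry-toℕ t j = cong (finToFun t) (toℕ-injective (trans (toℕ-fromℕ< _) (m<n⇒m%n≡m (toℕ<n j))))

    entry-+p : ∀ t k → entry t (k + p) ≡ entry t k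
    entry-+p t k = cong (finToFun t) (mod-cong {k + p} {k} ([m+n]%n≡m%n k p))

    tuple-ext : ∀ {t t′} → (∀ k → entry t k ≡ entry t′ k) → t ≡ t′
    tuple-ext {t} {t′} t≗t′ = begin
      t                               ≡⟨ funToFin-finToFin {p} {n} t ⟨
      funToFin (finToFun {n} {p} t)   ≡⟨ funToFin-cong t≗t′ᶠ ⟩
      funToFin (finToFun {n} {p} t′)  ≡⟨ funToFin-finToFin {p} {n} t′ ⟩
      t′                              ∎
      where
      open ≡-Reasoning
      t≗t′ᶠ : ∀ j → finToFun t j ≡ finToFun t′ j
      t≗t′ᶠ j = trans (sym (entry-toℕ t j)) (trans (t≗t′ (toℕ j)) (entry-toℕ t′ j))

    rotate : Tuple → Tuple
    rotate t = funToFin {p} {n} (λ j → entry t (suc (toℕ j)))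

    entry-rotate : ∀ t k → entry (rotate t) k ≡ entry t (suc k)
    entry-rotate t k = trans (finToFun-funToFin (λ j → entry t (suc (toℕ j))) (k mod p))
      (cong (finToFun t) (mod-cong {suc (toℕ (k mod p))} {suc k} (begin
        suc (toℕ (k mod p)) % p          ≡⟨ cong (λ r → suc r % p) (toℕ-fromℕ< _) ⟩
        (1 + k % p) % p                  ≡⟨ %-distribˡ-+ 1 (k % p) p ⟩
        (1 % p + k % p % p) % p          ≡⟨ cong (λ r → (1 % p + r) % p) (m%n%n≡m%n k p) ⟩
        (1 % p + k % p) % p              ≡⟨ %-distribˡ-+ 1 k p ⟨
        suc k % p                        ∎)))
      where open ≡-Reasoning

    entry-rotate^ : ∀ m t k → entry (fold t rotate m) k ≡ entry t (k + m)
    entry-rotate^ zero    t k = cong (entry t) (sym (+-identityʳ k))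
    entry-rotate^ (suc m) t k = trans (entry-rotate (fold t rotate m) k)
      (trans (entry-rotate^ m t (suc k)) (cong (entry t) (sym (+-suc k m))))

    rotate-periodic : ∀ t → fold t rotate p ≡ t
    rotate-periodic t = tuple-ext (λ k → trans (entry-rotate^ p t k) (entry-+p t k))

    Fixed : Tuple → Bool
    Fixed t = ⌊ rotate t Fin.≟ t ⌋

    rotate^-fixed⇒fixed : ∀ {t m} → 0 < m → m < p → fold t rotate m ≡ t → rotate t ≡ t
    rotate^-fixed⇒fixed {t} {m} m>0 m<p rotateᵐt≡t = tuple-ext λ k →
      trans (entry-rotate t k) (coprime-periods⇒constant (entry t) m⊥p period-m (entry-+p t) k)
      where
      m⊥p : Coprime m p
      m⊥p = Coprimality.sym (prime⇒coprime p-prime {{>-nonZero m>0}} m<p)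
      period-m : ∀ k → entry t (k + m) ≡ entry t k
      period-m k = trans (sym (entry-rotate^ m t k)) (cong (λ s → entry s k) rotateᵐt≡t)

    fixed⇒constant : ∀ {t} → rotate t ≡ t → ∀ k → entry t k ≡ entry t 0
    fixed⇒constant fixed zero    = refl
    fixed⇒constant fixed (suc k) =
      trans (sym (entry-rotate _ k)) (trans (cong (λ s → entry s k) fixed) (fixed⇒constant fixed k))

    product : Tuple → Fin n
    product t = ∏ℕ (entry t) p

    HasProductE : Tuple → Bool
    HasProductE t = ⌊ product t Fin.≟ e ⌋

    product-rotate : ∀ t → product t ≡ e → product (rotate t) ≡ e
    product-rotate t t∏≡e = begin
      ∏ℕ (entry (rotate t)) p  ≡⟨ ∏ℕ-cong p (entry-rotate t) ⟩
      ∏ℕ tail p                ≡⟨ ∏ℕ-snoc tail q ⟩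
      ∏ℕ tail q ∙ entry t p    ≡⟨ cong (∏ℕ tail q ∙_) (entry-+p t 0) ⟩
      ∏ℕ tail q ∙ entry t 0    ≡⟨ ∙≡e⇒∙-comm t∏≡e ⟩
      e                        ∎
      where
      open ≡-Reasoning
      tail : ℕ → Fin n
      tail k = entry t (suc k)

    ∏tail : Fin (n ^ q) → Fin n
    ∏tail r = ∏ (finToFun {n} {q} r)

    product-combine : ∀ a r → product (combine a r) ≡ a ∙ ∏tail r
    product-combine a r = trans (∏-cong {p} (entry-toℕ (combine a r)))
      (cong₂ _∙_ (cong proj₁ (remQuot-combine a r))
                 (∏-cong {q} (λ j → cong (λ ar → finToFun (proj₂ ar) j) (remQuot-combine a r))))

    count-HasProductE : count HasProductE ≡ n ^ q
    count-HasProductE = begin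
      count HasProductE
        ≡⟨ ∑-combine n (n ^ q) (λ t → indicator (HasProductE t)) ⟩
      ∑[ a < n ] ∑[ r < n ^ q ] indicator (HasProductE (combine a r))
        ≡⟨ sum-cong-≗ {n} (λ a → sum-cong-≗ {n ^ q} (cong indicator ∘ HasProductE-combine a)) ⟩
      ∑[ a < n ] ∑[ r < n ^ q ] indicator (singleton (∏tail r ⁻¹) a)
        ≡⟨ ∑-comm (λ a r → indicator (singleton (∏tail r ⁻¹) a)) ⟩
      ∑[ r < n ^ q ] count (singleton (∏tail r ⁻¹))
        ≡⟨ sum-cong-≗ {n ^ q} (λ r → count-singleton (∏tail r ⁻¹)) ⟩
      ∑[ r < n ^ q ] 1
        ≡⟨ ∑-const-1 (n ^ q) ⟩
      n ^ q ∎
      where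
      open ≡-Reasoning
      HasProductE-combine : ∀ a r → HasProductE (combine a r) ≡ singleton (∏tail r ⁻¹) a
      HasProductE-combine a r = ⌊⌋-⇔ (product (combine a r) Fin.≟ e) (a Fin.≟ ∏tail r ⁻¹) (mk⇔
        (λ t∏≡e → inverseˡ-unique a _ (trans (sym (product-combine a r)) t∏≡e))
        (λ a≡c⁻¹ → trans (product-combine a r) (trans (cong (_∙ ∏tail r) a≡c⁻¹) (inverseˡ _))))

    open PeriodicMap rotate p rotate-periodic using (Closed; Free; σ-injective; k∣count)

    closed-HasProductE : Closed HasProductE
    closed-HasProductE t t∈ = fromWitness (product-rotate t (toWitness t∈))

    closed-HasProductE∖Fixed : Closed (HasProductE ∖ Fixed)
    closed-HasProductE∖Fixed t t∈ with to (∈-∖ HasProductE Fixed t) t∈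
    ... | t∈S , t∉Fixed =
      from (∈-∖ HasProductE Fixed (rotate t)) (closed-HasProductE t t∈S , rotate-t∉Fixed)
      where
      rotate-t∉Fixed : ¬ T (Fixed (rotate t))
      rotate-t∉Fixed rotate-t∈Fixed = t∉Fixed (fromWitness (σ-injective (toWitness rotate-t∈Fixed)))

    free-HasProductE∖Fixed : Free (HasProductE ∖ Fixed)
    free-HasProductE∖Fixed t t∈ m m>0 m<p rotateᵐt≡t =
      proj₂ (to (∈-∖ HasProductE Fixed t) t∈) (fromWitness (rotate^-fixed⇒fixed m>0 m<p rotateᵐt≡t))

    constant-e : Tuple
    constant-e = funToFin {p} {n} (λ _ → e)

    entry-constant-e : ∀ k → entry constant-e k ≡ e
    entry-constant-e k = finToFun-funToFin (λ _ → e) (k mod p)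

    constant-e∈ : T ((HasProductE ∩ Fixed) constant-e)
    constant-e∈ = from (∈-∩ HasProductE Fixed constant-e)
      ( fromWitness (trans (∏ℕ-cong p entry-constant-e) (∏-e p))
      , fromWitness (tuple-ext (λ k → trans (entry-rotate constant-e k)
                                           (trans (entry-constant-e (suc k)) (sym (entry-constant-e k))))))

    nonconstant-fixed-tuple⇒order-p : ∀ {t} → T ((HasProductE ∩ Fixed) t) → t ≢ constant-e →
                                       IsOrder G (entry t 0) p
    nonconstant-fixed-tuple⇒order-p {t} t∈ t≢constant-e = prime-order p-prime g≢e gᵖ≡e
      where
      fixed = toWitness (proj₂ (to (∈-∩ HasProductE Fixed t) t∈))
      gᵖ≡e : pow G (entry t 0) p ≡ e
      gᵖ≡e = begin
        pow G (entry t 0) p             ≡⟨ ∏-const p (entry t 0) ⟨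
        ∏ {p} (λ _ → entry t 0)         ≡⟨ ∏ℕ-cong p (fixed⇒constant fixed) ⟨
        product t                       ≡⟨ toWitness (proj₁ (to (∈-∩ HasProductE Fixed t) t∈)) ⟩
        e                               ∎
        where open ≡-Reasoning
      g≢e : entry t 0 ≢ e
      g≢e g≡e = t≢constant-e (tuple-ext λ k →
        trans (fixed⇒constant fixed k) (trans g≡e (sym (entry-constant-e k))))

    module _ (p∣n^q : p ∣ n ^ q) where

      p∣count-fixed : p ∣ count (HasProductE ∩ Fixed)
      p∣count-fixed = ∣m+n∣m⇒∣n
        (subst (p ∣_) (trans (sym count-HasProductE) (trans (count-split HasProductE Fixed)
          (+-comm (count (HasProductE ∩ Fixed)) (count (HasProductE ∖ Fixed))))) p∣n^q)
        (k∣count (HasProductE ∖ Fixed) closed-HasProductE∖Fixed free-HasProductE∖Fixed)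

      element-of-order-p : ∃[ g ] IsOrder G g p
      element-of-order-p =
        let t , t∈ , t≢constant-e = ∃-another (HasProductE ∩ Fixed) (prime>1 p-prime) p∣count-fixed constant-e∈
        in entry t 0 , nonconstant-fixed-tuple⇒order-p t∈ t≢constant-e

  cauchy : ∀ {p} → Prime p → p ∣ n → ∃[ g ] IsOrder G g p
  cauchy {suc (suc q)} p-prime p∣n =
    McKay.element-of-order-p (suc q) p-prime (∣-trans p∣n (m∣m*n (n ^ q)))
  cauchy {0} p-prime = ⊥-elim (<⇒≱ (prime>1 p-prime) z≤n)
  cauchy {1} p-prime = ⊥-elim (<-irrefl refl (prime>1 p-prime))

-- Line graphs

_∈ᵖ_ : ∀ {m} → Fin m → Fin m × Fin m → Set
z ∈ᵖ (c , d) = z ≡ c ⊎ z ≡ d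

NonAdjacent : {V : Set} → (V → V → Set) → V → V → Set
NonAdjacent Adj u v = u ≢ v × ¬ Adj u v

module LineGraph {V : Set} {Adj : V → V → Set} (adj⇒≢ : ∀ {u v} → Adj u v → u ≢ v)
                 {Γ : SimpleGraph} (isLineGraph : IsLineGraphOf V Adj Γ) where
  open SimpleGraph Γ using (m; E; irrefl)

  edge : V → Fin m × Fin m
  edge = proj₁ isLineGraph

  edge∈Γ : ∀ u → E (proj₁ (edge u)) (proj₂ (edge u))
  edge∈Γ = proj₁ (proj₂ isLineGraph)

  edge-injective : ∀ u v → SameEdge (edge u) (edge v) → u ≡ v
  edge-injective = proj₁ (proj₂ (proj₂ isLineGraph))

  adjacent⇔share-end : ∀ u v → u ≢ v → Adj u v ⇔ ShareEnd (edge u) (edge v)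
  adjacent⇔share-end = proj₂ (proj₂ (proj₂ (proj₂ isLineGraph)))

  _∈ₑ_ : Fin m → V → Set
  z ∈ₑ u = z ∈ᵖ edge u

  endpoints-≢ : ∀ u → proj₁ (edge u) ≢ proj₂ (edge u)
  endpoints-≢ u ends≡ = irrefl (subst (λ z → E z (proj₂ (edge u))) ends≡ (edge∈Γ u))

  same-endpoints⇒≡ : ∀ {u v z z′} → z ≢ z′ →
                     z ∈ₑ u → z′ ∈ₑ u → z ∈ₑ v → z′ ∈ₑ v → u ≡ v
  same-endpoints⇒≡ {u} {v} {z} {z′} z≢z′ z∈u z′∈u z∈v z′∈v =
    edge-injective u v (same (edge u) (edge v) z∈u z′∈u z∈v z′∈v)
    where
    same : ∀ P Q → z ∈ᵖ P → z′ ∈ᵖ P → z ∈ᵖ Q → z′ ∈ᵖ Q → SameEdge P Q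
    same _ _ (inj₁ refl) (inj₁ refl) _           _           = ⊥-elim (z≢z′ refl)
    same _ _ (inj₂ refl) (inj₂ refl) _           _           = ⊥-elim (z≢z′ refl)
    same _ _ _           _           (inj₁ refl) (inj₁ refl) = ⊥-elim (z≢z′ refl)
    same _ _ _           _           (inj₂ refl) (inj₂ refl) = ⊥-elim (z≢z′ refl)
    same _ _ (inj₁ refl) (inj₂ refl) (inj₁ refl) (inj₂ refl) = inj₁ (refl , refl)
    same _ _ (inj₁ refl) (inj₂ refl) (inj₂ refl) (inj₁ refl) = inj₂ (refl , refl)
    same _ _ (inj₂ refl) (inj₁ refl) (inj₁ refl) (inj₂ refl) = inj₂ (refl , refl)
    same _ _ (inj₂ refl) (inj₁ refl) (inj₂ refl) (inj₁ refl) = inj₁ (refl , refl)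

  shared-endpoint-unique : ∀ {u v z z′} → u ≢ v →
                           z ∈ₑ u → z ∈ₑ v → z′ ∈ₑ u → z′ ∈ₑ v → z ≡ z′
  shared-endpoint-unique {z = z} {z′} u≢v z∈u z∈v z′∈u z′∈v with z Fin.≟ z′
  ... | yes z≡z′ = z≡z′
  ... | no  z≢z′ = ⊥-elim (u≢v (same-endpoints⇒≡ z≢z′ z∈u z′∈u z∈v z′∈v))

  endpoint-cases : ∀ {u z z′ w} → z ≢ z′ → z ∈ₑ u → z′ ∈ₑ u → w ∈ₑ u → w ≡ z ⊎ w ≡ z′
  endpoint-cases z≢z′ (inj₁ refl) (inj₁ refl) _           = ⊥-elim (z≢z′ refl)
  endpoint-cases z≢z′ (inj₂ refl) (inj₂ refl) _           = ⊥-elim (z≢z′ refl)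
  endpoint-cases z≢z′ (inj₁ refl) (inj₂ refl) (inj₁ refl) = inj₁ refl
  endpoint-cases z≢z′ (inj₁ refl) (inj₂ refl) (inj₂ refl) = inj₂ refl
  endpoint-cases z≢z′ (inj₂ refl) (inj₁ refl) (inj₁ refl) = inj₂ refl
  endpoint-cases z≢z′ (inj₂ refl) (inj₁ refl) (inj₂ refl) = inj₁ refl

  other-endpoint : ∀ {u z} → z ∈ₑ u → ∃[ ξ ] (ξ ∈ₑ u × z ≢ ξ)
  other-endpoint {u} (inj₁ refl) = proj₂ (edge u) , inj₂ refl , endpoints-≢ u
  other-endpoint {u} (inj₂ refl) = proj₁ (edge u) , inj₁ refl , λ ends≡ → endpoints-≢ u (sym ends≡)

  adjacent⇒shared-endpoint : ∀ {u v} → Adj u v → ∃[ z ] (z ∈ₑ u × z ∈ₑ v)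
  adjacent⇒shared-endpoint {u} {v} u~v with to (adjacent⇔share-end u v (adj⇒≢ u~v)) u~v
  ... | inj₁ z∈v = proj₁ (edge u) , inj₁ refl , z∈v
  ... | inj₂ z∈v = proj₂ (edge u) , inj₂ refl , z∈v

  nonAdjacent⇒disjoint : ∀ {u v z} → NonAdjacent Adj u v → z ∈ₑ u → z ∈ₑ v → ⊥
  nonAdjacent⇒disjoint {u} {v} {z} (u≢v , u≁v) z∈u z∈v =
    u≁v (from (adjacent⇔share-end u v u≢v) (share (edge u) (edge v) z∈u z∈v))
    where
    share : ∀ P Q → z ∈ᵖ P → z ∈ᵖ Q → ShareEnd P Q
    share _ (c , d) (inj₁ refl) z∈Q = inj₁ z∈Q
    share _ (c , d) (inj₂ refl) z∈Q = inj₂ z∈Q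

  adjacent-at-other-endpoint : ∀ {u v z z′} → Adj u v → ¬ z ∈ₑ v → z ≢ z′ →
                               z ∈ₑ u → z′ ∈ₑ u → z′ ∈ₑ v
  adjacent-at-other-endpoint u~v z∉v z≢z′ z∈u z′∈u with adjacent⇒shared-endpoint u~v
  ... | w , w∈u , w∈v with endpoint-cases z≢z′ z∈u z′∈u w∈u
  ...   | inj₁ refl = ⊥-elim (z∉v w∈v)
  ...   | inj₂ refl = w∈v

  -- The edge a has an endpoint α on x and on y (y misses the endpoint β that a shares with s);
  -- a common neighbour of x and y avoiding α must join the other endpoints ξ ≠ η of x and y.
  common-neighbour-unique : ∀ {a x y s b b′} →
    Adj a x → Adj a y → Adj a s → NonAdjacent Adj x s → NonAdjacent Adj y s → x ≢ y →
    Adj x b → Adj y b → NonAdjacent Adj a b →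
    Adj x b′ → Adj y b′ → NonAdjacent Adj a b′ → b ≡ b′
  common-neighbour-unique {a} {x} {y} a~x a~y a~s x≁s y≁s x≢y x~b y~b a≁b x~b′ y~b′ a≁b′
    with adjacent⇒shared-endpoint a~x | adjacent⇒shared-endpoint a~s
  ... | α , α∈a , α∈x | β , β∈a , β∈s =
    same-endpoints⇒≡ ξ≢η (ξ∈ x~b a≁b) (η∈ y~b a≁b) (ξ∈ x~b′ a≁b′) (η∈ y~b′ a≁b′)
    where
    β≢α : β ≢ α
    β≢α refl = nonAdjacent⇒disjoint x≁s α∈x β∈s
    α∈y : α ∈ₑ y
    α∈y = adjacent-at-other-endpoint a~y (λ β∈y → nonAdjacent⇒disjoint y≁s β∈y β∈s) β≢α β∈a α∈a
    ξ = proj₁ (other-endpoint α∈x)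
    η = proj₁ (other-endpoint α∈y)
    ξ∈x = proj₁ (proj₂ (other-endpoint α∈x))
    η∈y = proj₁ (proj₂ (other-endpoint α∈y))
    α≢ξ = proj₂ (proj₂ (other-endpoint α∈x))
    α≢η = proj₂ (proj₂ (other-endpoint α∈y))
    ξ≢η : ξ ≢ η
    ξ≢η ξ≡η = x≢y (same-endpoints⇒≡ α≢ξ α∈x ξ∈x α∈y (subst (_∈ₑ y) (sym ξ≡η) η∈y))
    ξ∈ : ∀ {b} → Adj x b → NonAdjacent Adj a b → ξ ∈ₑ b
    ξ∈ x~b a≁b = adjacent-at-other-endpoint x~b (nonAdjacent⇒disjoint a≁b α∈a) α≢ξ α∈x ξ∈x
    η∈ : ∀ {b} → Adj y b → NonAdjacent Adj a b → η ∈ₑ b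
    η∈ y~b a≁b = adjacent-at-other-endpoint y~b (nonAdjacent⇒disjoint a≁b α∈a) α≢η α∈y η∈y

  module _ {P P′ x y : V} (P≢P′ : P ≢ P′) (x≢y : x ≢ y)
           (P≁x : NonAdjacent Adj P x) (P′≁x : NonAdjacent Adj P′ x) (P≁y : NonAdjacent Adj P y) where

    -- u joins the endpoint shared by P and P′ to the one shared by x and y, so it is unique.
    record Straddling (u : V) : Set where
      field
        π χ      : Fin m
        π≢χ      : π ≢ χ
        π∈u      : π ∈ₑ u
        χ∈u      : χ ∈ₑ u
        π∈P      : π ∈ₑ P
        π∈P′     : π ∈ₑ P′
        χ∈x      : χ ∈ₑ x
        χ∈y      : χ ∈ₑ y

    straddling : ∀ {u} → Adj u P → Adj u P′ → Adj u x → Adj u y → Straddling u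
    straddling u~P u~P′ u~x u~y with adjacent⇒shared-endpoint u~P | adjacent⇒shared-endpoint u~x
    ... | π , π∈u , π∈P | χ , χ∈u , χ∈x = record
      { π∈u = π∈u ; χ∈u = χ∈u ; π∈P = π∈P ; χ∈x = χ∈x ; π≢χ = π≢χ
      ; π∈P′ = adjacent-at-other-endpoint u~P′ (λ χ∈P′ → nonAdjacent⇒disjoint P′≁x χ∈P′ χ∈x)
                                          (≢-sym π≢χ) χ∈u π∈u
      ; χ∈y = adjacent-at-other-endpoint u~y (λ π∈y → nonAdjacent⇒disjoint P≁y π∈P π∈y) π≢χ π∈u χ∈u
      }
      where
      π≢χ : π ≢ χ
      π≢χ refl = nonAdjacent⇒disjoint P≁x π∈P χ∈x

    straddling-unique : ∀ {u u′} → Straddling u → Straddling u′ → u ≡ u′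
    straddling-unique {u} {u′} s s′ = same-endpoints⇒≡ π≢χ π∈u χ∈u
      (subst (_∈ₑ u′) (sym π≡π′) (Straddling.π∈u s′))
      (subst (_∈ₑ u′) (sym χ≡χ′) (Straddling.χ∈u s′))
      where
      open Straddling s
      π≡π′ : π ≡ Straddling.π s′
      π≡π′ = shared-endpoint-unique P≢P′ π∈P π∈P′ (Straddling.π∈P s′) (Straddling.π∈P′ s′)
      χ≡χ′ : χ ≡ Straddling.χ s′
      χ≡χ′ = shared-endpoint-unique x≢y χ∈x χ∈y (Straddling.χ∈x s′) (Straddling.χ∈y s′)

edge-map⇒line-graph : ∀ {V : Set} {Adj : V → V → Set} {m} (f : V → Fin m × Fin m) →
  (∀ v → proj₁ (f v) ≢ proj₂ (f v)) → (∀ u v → SameEdge (f u) (f v) → u ≡ v) →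
  (∀ u v → u ≢ v → (Adj u v ⇔ ShareEnd (f u) (f v))) → IsLineGraph V Adj
edge-map⇒line-graph {V} {m = m} f proper injective adjacency =
  Γ , f , (λ v → v , inj₁ (refl , refl)) , injective , (λ a b ab∈Γ → ab∈Γ) , adjacency
  where
  Edge : Fin m → Fin m → Set
  Edge a b = ∃[ v ] SameEdge (f v) (a , b)
  Γ : SimpleGraph
  Γ = record
    { m = m
    ; E = Edge
    ; sym = λ (v , fv≈ab) → v , Sum.swap fv≈ab
    ; irrefl = λ where
        (v , inj₁ (f₁≡a , f₂≡a)) → proper v (trans f₁≡a (sym f₂≡a))
        (v , inj₂ (f₁≡a , f₂≡a)) → proper v (trans f₁≡a (sym f₂≡a))
    }

-- The order supergraph

module OrderSupergraph (G : FiniteGroup) where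
  open FiniteGroup G
  open GroupTheory G
  open Cauchy G using (cauchy)

  n>0 : 0 < n
  n>0 = >-nonZero⁻¹ n {{Fin.nonZeroIndex e}}

  S**Adj⇒≢ : ∀ {u v} → S**Adj G u v → u ≢ v
  S**Adj⇒≢ (x≢y , _) u≡v = x≢y (cong value u≡v)

  comparable⇒adjacent : ∀ {x y a b} → IsOrder G x a → IsOrder G y b →
                        x ≢ y → a ∣ b ⊎ b ∣ a → SAdj G x y
  comparable⇒adjacent order-a order-b x≢y a≍b = x≢y , λ a′ b′ order-a′ order-b′ →
    subst₂ (λ a b → a ∣ b ⊎ b ∣ a) (order-unique order-a order-a′) (order-unique order-b order-b′) a≍b

  strict-divisor⇒adjacent : ∀ {x y a b} → IsOrder G x a → IsOrder G y b →
                            a ∣ b → ¬ b ∣ a → SAdj G x y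
  strict-divisor⇒adjacent order-a order-b a∣b b∤a =
    comparable⇒adjacent order-a order-b (order-≢⇒≢ order-a order-b λ { refl → b∤a ∣-refl })
                        (inj₁ a∣b)

  strict-multiple⇒adjacent : ∀ {x y a b} → IsOrder G x a → IsOrder G y b →
                             b ∣ a → ¬ a ∣ b → SAdj G x y
  strict-multiple⇒adjacent order-a order-b b∣a a∤b =
    comparable⇒adjacent order-a order-b (order-≢⇒≢ order-a order-b λ { refl → a∤b ∣-refl })
                        (inj₂ b∣a)

  incomparable⇒≢ : ∀ {x y a b} → IsOrder G x a → IsOrder G y b → Incomparable a b → x ≢ y
  incomparable⇒≢ order-a order-b (a∤b , _) = order-≢⇒≢ order-a order-b λ { refl → a∤b ∣-refl }

  incomparable⇒¬adjacent : ∀ {x y a b} → IsOrder G x a → IsOrder G y b → Incomparable a b → ¬ SAdj G x y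
  incomparable⇒¬adjacent order-a order-b (a∤b , b∤a) (_ , a≍b) =
    Sum.[ a∤b , b∤a ] (a≍b _ _ order-a order-b)

  incomparable⇒nonAdjacent : ∀ {u v a b} → IsOrder G (value u) a → IsOrder G (value v) b →
                             Incomparable a b → NonAdjacent (S**Adj G) u v
  incomparable⇒nonAdjacent order-a order-b a⊥b =
    (λ u≡v → incomparable⇒≢ order-a order-b a⊥b (cong value u≡v)) ,
    incomparable⇒¬adjacent order-a order-b a⊥b

  incomparable⇒¬dominating : ∀ {x w a b} → IsOrder G x a → IsOrder G w b →
                             Incomparable a b → ¬ Dominating G x
  incomparable⇒¬dominating order-a order-b a⊥b x-dominating =
    incomparable⇒¬adjacent order-a order-b a⊥b (x-dominating _ (incomparable⇒≢ order-b order-a (swap a⊥b)))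

  vertexOfOrder : ∀ {x w a b} → IsOrder G x a → IsOrder G w b → Incomparable a b → S**Vertex G
  vertexOfOrder {x} order-a order-b a⊥b = x , [ incomparable⇒¬dominating order-a order-b a⊥b ]

  module Dominated {v : Fin n} (v≢e : v ≢ e) (v-dominating : Dominating G v) where
    d : ℕ
    d = proj₁ (order v)

    order-d : IsOrder G v d
    order-d = proj₂ (order v)

    order∣d-or-d∣order : ∀ {g c} → IsOrder G g c → c ∣ d ⊎ d ∣ c
    order∣d-or-d∣order {g} order-c with g Fin.≟ v
    ... | yes refl = inj₁ (∣-reflexive (order-unique order-c order-d))
    ... | no  g≢v  = Sum.swap (proj₂ (v-dominating g g≢v) d _ order-d order-c)

    prime∣|G|⇒prime∣d : ∀ {r} → Prime r → r ∣ n → r ∣ d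
    prime∣|G|⇒prime∣d r-prime r∣n with cauchy r-prime r∣n
    ... | g , order-r with order∣d-or-d∣order order-r
    ...   | inj₁ r∣d = r∣d
    ...   | inj₂ d∣r with prime⇒irreducible r-prime d∣r
    ...     | inj₁ d≡1 = ⊥-elim (v≢e (order≡1⇒≡e (subst (IsOrder G v) d≡1 order-d)))
    ...     | inj₂ d≡r = ∣-reflexive (sym d≡r)

    element : ∀ c → c ∣ d → Fin n
    element c (divides c′ _) = pow G v c′

    element-order : ∀ c (c∣d : c ∣ d) → IsOrder G (element c c∣d) c
    element-order c (divides c′ d≡c′c) = order-pow c′ c (subst (IsOrder G v) d≡c′c order-d)

    module _ {Γ : SimpleGraph} (isLineGraph : IsLineGraphOf (S**Vertex G) (S**Adj G) Γ) where
      open LineGraph {S**Vertex G} {S**Adj G} S**Adj⇒≢ {Γ} isLineGraph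

      ¬three-primes : ∀ {p q r} → Prime p → Prime q → Prime r → p ≢ q → p ≢ r → q ≢ r → 2 < q →
                      p ∣ n → q ∣ n → r ∣ n → ⊥
      ¬three-primes {p} {q} {r} p-prime q-prime r-prime p≢q p≢r q≢r 2<q p∣n q∣n r∣n =
        order>2⇒⁻¹≢ ob 2<q (sym (cong value B≡B′))
        where
        instance
          p≢0 = prime⇒nonZero p-prime
          q≢0 = prime⇒nonZero q-prime
        p∣d = prime∣|G|⇒prime∣d p-prime p∣n
        q∣d = prime∣|G|⇒prime∣d q-prime q∣n
        r∣d = prime∣|G|⇒prime∣d r-prime r∣n
        oa = element-order p p∣d
        ox = element-order (p * q) (primes⇒product∣ p-prime q-prime p≢q p∣d q∣d)
        oy = order-⁻¹ ox
        os = element-order (p * r) (primes⇒product∣ p-prime r-prime p≢r p∣d r∣d)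
        ob = element-order q q∣d
        ob′ = order-⁻¹ ob
        oc = element-order r r∣d
        p⊥q = distinct-primes-incomparable p-prime q-prime p≢q
        p⊥r = distinct-primes-incomparable p-prime r-prime p≢r
        q∤pr = prime∤product q-prime p-prime r-prime (≢-sym p≢q) q≢r
        r∤pq = prime∤product r-prime p-prime q-prime (≢-sym p≢r) (≢-sym q≢r)
        pq⊥r = incomparable-by-witnesses (m∣m*n q) (proj₁ p⊥r) ∣-refl r∤pq
        pr⊥q = incomparable-by-witnesses (m∣m*n r) (proj₁ p⊥q) ∣-refl q∤pr
        pq⊥pr = incomparable-by-witnesses (n∣m*n p) q∤pr (n∣m*n p) r∤pq
        A  = vertexOfOrder oa ob p⊥q
        X  = vertexOfOrder ox oc pq⊥r
        Y  = vertexOfOrder oy oc pq⊥r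
        S  = vertexOfOrder os ob pr⊥q
        B  = vertexOfOrder ob oa (swap p⊥q)
        B′ = vertexOfOrder ob′ oa (swap p⊥q)
        X≢Y : X ≢ Y
        X≢Y X≡Y = order>2⇒⁻¹≢ ox (2<p*q p-prime 2<q) (sym (cong value X≡Y))
        B≡B′ : B ≡ B′
        B≡B′ = common-neighbour-unique {A} {X} {Y} {S} {B} {B′}
          (strict-divisor⇒adjacent oa ox (m∣m*n q) (¬m*n∣m q-prime))
          (strict-divisor⇒adjacent oa oy (m∣m*n q) (¬m*n∣m q-prime))
          (strict-divisor⇒adjacent oa os (m∣m*n r) (¬m*n∣m r-prime))
          (incomparable⇒nonAdjacent ox os pq⊥pr) (incomparable⇒nonAdjacent oy os pq⊥pr) X≢Y
          (strict-multiple⇒adjacent ox ob (n∣m*n p) (¬m*n∣n p-prime))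
          (strict-multiple⇒adjacent oy ob (n∣m*n p) (¬m*n∣n p-prime))
          (incomparable⇒nonAdjacent oa ob p⊥q)
          (strict-multiple⇒adjacent ox ob′ (n∣m*n p) (¬m*n∣n p-prime))
          (strict-multiple⇒adjacent oy ob′ (n∣m*n p) (¬m*n∣n p-prime))
          (incomparable⇒nonAdjacent oa ob′ p⊥q)

      module _ {s t} (s-prime : Prime s) (t-prime : Prime t) (s≢t : s ≢ t) (s∣n : s ∣ n) (t∣n : t ∣ n)
               (ss∣d : s * s ∣ d) where
        private
          instance
            s≢0 = prime⇒nonZero s-prime
            t≢0 = prime⇒nonZero t-prime
          s∣d = prime∣|G|⇒prime∣d s-prime s∣n
          t∣d = prime∣|G|⇒prime∣d t-prime t∣n
          oa = element-order s s∣d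
          st∣d = primes⇒product∣ s-prime t-prime s≢t s∣d t∣d
          ox = element-order (s * t) st∣d
          oy = order-⁻¹ ox
          oP = element-order (s * s) ss∣d
          ob = element-order t t∣d
          s⊥t = distinct-primes-incomparable s-prime t-prime s≢t
          t∤ss = prime∤product t-prime s-prime s-prime (≢-sym s≢t) (≢-sym s≢t)
          st⊥ss : Incomparable (s * t) (s * s)
          st⊥ss = (λ st∣ss → t∤ss (∣-trans (n∣m*n s) st∣ss)) , ¬p*p∣p*q s-prime t-prime s≢t
          ss⊥t = incomparable-by-witnesses (m∣m*n s) (proj₁ s⊥t) ∣-refl t∤ss
          X = vertexOfOrder ox oP st⊥ss
          Y = vertexOfOrder oy oP st⊥ss
          X≢Y : 2 < s * t → X ≢ Y
          X≢Y 2<st X≡Y = order>2⇒⁻¹≢ ox 2<st (sym (cong value X≡Y))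
          x~b : ∀ {z} (oz : IsOrder G z t) → SAdj G (element (s * t) st∣d) z
          x~b oz = strict-multiple⇒adjacent ox oz (n∣m*n s) (¬m*n∣n s-prime)
          y~b : ∀ {z} (oz : IsOrder G z t) → SAdj G (element (s * t) st∣d ⁻¹) z
          y~b oz = strict-multiple⇒adjacent oy oz (n∣m*n s) (¬m*n∣n s-prime)

        ¬square-of-2 : s ≡ 2 → ⊥
        ¬square-of-2 refl = order>2⇒⁻¹≢ ob 2<t (sym (cong value B≡B′))
          where
          2<t : 2 < t
          2<t = ≤∧≢⇒< (prime>1 t-prime) s≢t
          ob′ = order-⁻¹ ob
          A  = vertexOfOrder oa ob s⊥t
          P  = vertexOfOrder oP ob ss⊥t
          B  = vertexOfOrder ob oa (swap s⊥t)
          B′ = vertexOfOrder ob′ oa (swap s⊥t)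
          B≡B′ : B ≡ B′
          B≡B′ = common-neighbour-unique {A} {X} {Y} {P} {B} {B′}
            (strict-divisor⇒adjacent oa ox (m∣m*n t) (¬m*n∣m t-prime))
            (strict-divisor⇒adjacent oa oy (m∣m*n t) (¬m*n∣m t-prime))
            (strict-divisor⇒adjacent oa oP (m∣m*n s) (¬m*n∣m s-prime))
            (incomparable⇒nonAdjacent ox oP st⊥ss) (incomparable⇒nonAdjacent oy oP st⊥ss)
            (X≢Y (2<p*q s-prime 2<t))
            (x~b ob) (y~b ob) (incomparable⇒nonAdjacent oa ob s⊥t)
            (x~b ob′) (y~b ob′) (incomparable⇒nonAdjacent oa ob′ s⊥t)

        ¬square-of-odd : s ≢ 2 → ⊥
        ¬square-of-odd s≢2 = order>2⇒⁻¹≢ oa 2<s (sym (cong value U≡U′))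
          where
          2<s : 2 < s
          2<s = ≤∧≢⇒< (prime>1 s-prime) (≢-sym s≢2)
          oa′ = order-⁻¹ oa
          oP′ = order-⁻¹ oP
          U  = vertexOfOrder oa ob s⊥t
          U′ = vertexOfOrder oa′ ob s⊥t
          P  = vertexOfOrder oP ob ss⊥t
          P′ = vertexOfOrder oP′ ob ss⊥t
          P≢P′ : P ≢ P′
          P≢P′ P≡P′ = order>2⇒⁻¹≢ oP (2<p*q s-prime 2<s) (sym (cong value P≡P′))
          2<st : 2 < s * t
          2<st = subst (2 <_) (*-comm t s) (2<p*q t-prime 2<s)
          P≁X = incomparable⇒nonAdjacent {P} {X} oP ox (swap st⊥ss)
          P′≁X = incomparable⇒nonAdjacent {P′} {X} oP′ ox (swap st⊥ss)
          P≁Y = incomparable⇒nonAdjacent {P} {Y} oP oy (swap st⊥ss)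
          straddles : ∀ {u} → IsOrder G (value u) s → Straddling P≢P′ (X≢Y 2<st) P≁X P′≁X P≁Y u
          straddles ou = straddling P≢P′ (X≢Y 2<st) P≁X P′≁X P≁Y
            (strict-divisor⇒adjacent ou oP (m∣m*n s) (¬m*n∣m s-prime))
            (strict-divisor⇒adjacent ou oP′ (m∣m*n s) (¬m*n∣m s-prime))
            (strict-divisor⇒adjacent ou ox (m∣m*n t) (¬m*n∣m t-prime))
            (strict-divisor⇒adjacent ou oy (m∣m*n t) (¬m*n∣m t-prime))
          U≡U′ : U ≡ U′
          U≡U′ = straddling-unique P≢P′ (X≢Y 2<st) P≁X P′≁X P≁Y
                                   (straddles {U} oa) (straddles {U′} oa′)

      square∣order⇒square∣d : ∀ {s t g k} → Prime s → Prime t → s ≢ t → t ∣ n →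
                              IsOrder G g k → s * s ∣ k → s * s ∣ d
      square∣order⇒square∣d {s} s-prime t-prime s≢t t∣n order-k (divides c k≡c*ss)
        with order∣d-or-d∣order (order-pow c (s * s) (subst (IsOrder G _) k≡c*ss order-k))
      ... | inj₁ ss∣d = ss∣d
      ... | inj₂ d∣ss = ⊥-elim (t∤ss (∣-trans (prime∣|G|⇒prime∣d t-prime t∣n) d∣ss))
        where
        t∤ss = prime∤product t-prime s-prime s-prime (≢-sym s≢t) (≢-sym s≢t)

      ¬square∣order : ∀ {s t g k} → Prime s → Prime t → s ≢ t → s ∣ n → t ∣ n →
                      IsOrder G g k → s * s ∣ k → ⊥
      ¬square∣order {s} s-prime t-prime s≢t s∣n t∣n order-k ss∣k with s ≟ 2
      ... | yes s≡2 = ¬square-of-2 s-prime t-prime s≢t s∣n t∣n ss∣d s≡2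
        where ss∣d = square∣order⇒square∣d s-prime t-prime s≢t t∣n order-k ss∣k
      ... | no  s≢2 = ¬square-of-odd s-prime t-prime s≢t s∣n t∣n ss∣d s≢2
        where ss∣d = square∣order⇒square∣d s-prime t-prime s≢t t∣n order-k ss∣k

      ¬three-distinct-primes : ∀ {p q r} → Prime p → Prime q → Prime r → p ≢ q → p ≢ r → q ≢ r →
                               p ∣ n → q ∣ n → r ∣ n → ⊥
      ¬three-distinct-primes {p} {q} p-prime q-prime r-prime p≢q p≢r q≢r p∣n q∣n r∣n with q ≟ 2
      ... | yes refl = ¬three-primes q-prime p-prime r-prime (≢-sym p≢q) q≢r p≢r
                         (≤∧≢⇒< (prime>1 p-prime) (≢-sym p≢q)) q∣n p∣n r∣n
      ... | no  q≢2  = ¬three-primes p-prime q-prime r-prime p≢q p≢r q≢r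
                         (≤∧≢⇒< (prime>1 q-prime) (≢-sym q≢2)) p∣n q∣n r∣n

  line-graph⇒classified : Dominatable G → IsLineGraph (S**Vertex G) (S**Adj G) →
                          IsPGroup G ⊎ (TwoPrimeDivisors G × AllOrdersSquareFree G)
  line-graph⇒classified (v , v≢e , v-dominating) (Γ , isLineGraph) with n ≟ 1
  ... | yes n≡1 = inj₁ (2 , prime[2] , 0 , n≡1)
  ... | no  n≢1 with ∃-prime-factor (≤∧≢⇒< n>0 (≢-sym n≢1))
  ...   | p , p-prime , p∣n with prime-power-or-other-prime p-prime n n>0
  ...     | inj₁ (k , n≡pᵏ) = inj₁ (p , p-prime , k , n≡pᵏ)
  ...     | inj₂ (q , q-prime , q≢p , q∣n) with two-primes-or-third n n>0 p q
  ...       | inj₂ (r , r-prime , r≢p , r≢q , r∣n) =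
    ⊥-elim (¬three-distinct-primes {Γ} isLineGraph p-prime q-prime r-prime p≢q (≢-sym r≢p)
                                   (≢-sym r≢q) p∣n q∣n r∣n)
    where
    open Dominated v≢e v-dominating
    p≢q : p ≢ q
    p≢q p≡q = q≢p (sym p≡q)
  ...       | inj₁ only-p-q = inj₂ ((p , q , p-prime , q-prime , p≢q , p∣n , q∣n , only-p-q) , squarefree)
    where
    open Dominated v≢e v-dominating
    p≢q : p ≢ q
    p≢q p≡q = q≢p (sym p≡q)
    squarefree : AllOrdersSquareFree G
    squarefree x k order-k s s-prime ss∣k
      with only-p-q s s-prime (∣-trans (∣-trans (m∣m*n s) ss∣k) (order∣|G| order-k))
    ... | inj₁ refl = ¬square∣order {Γ} isLineGraph s-prime q-prime p≢q p∣n q∣n order-k ss∣k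
    ... | inj₂ refl = ¬square∣order {Γ} isLineGraph s-prime p-prime q≢p q∣n p∣n order-k ss∣k

  p-group⇒dominating : IsPGroup G → ∀ x → Dominating G x
  p-group⇒dominating (p , p-prime , k , n≡pᵏ) x w w≢x = (≢-sym w≢x) , λ a b order-a order-b →
    divisors-of-prime-power-comparable p-prime k
      (subst (a ∣_) n≡pᵏ (order∣|G| order-a)) (subst (b ∣_) n≡pᵏ (order∣|G| order-b))

  p-group⇒line-graph : IsPGroup G → IsLineGraph (S**Vertex G) (S**Adj G)
  p-group⇒line-graph p-group =
    edge-map⇒line-graph {m = 0} absurd (λ u → absurd u) (λ u _ → absurd u) (λ u _ _ → absurd u)
    where
    absurd : ∀ {A : Set} → S**Vertex G → A
    absurd (x , [ x-nondominating ]) = Irrelevant.⊥-elim (x-nondominating (p-group⇒dominating p-group x))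

  module TwoPrimes {p q} (p-prime : Prime p) (q-prime : Prime q) (p≢q : p ≢ q)
                   (only-p-q : ∀ r → Prime r → r ∣ n → r ≡ p ⊎ r ≡ q)
                   (squarefree : AllOrdersSquareFree G) where

    ord : Fin n → ℕ
    ord x = proj₁ (order x)

    order-of : ∀ x → IsOrder G x (ord x)
    order-of x = proj₂ (order x)

    order∣ : ∀ {x k K} → IsOrder G x k → (p ∣ k → p ∣ K) → (q ∣ k → q ∣ K) → k ∣ K
    order∣ {x} {k} order-k p⇒ q⇒ = squarefree⇒∣ (proj₁ order-k) (squarefree x k order-k) λ r r-prime r∣k →
      Sum.[ (λ { refl → p⇒ r∣k }) , (λ { refl → q⇒ r∣k }) ]
            (only-p-q r r-prime (∣-trans r∣k (order∣|G| order-k)))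

    comparable-with-all⇒dominating : ∀ {x k} → IsOrder G x k →
                                     (∀ {w b} → IsOrder G w b → k ∣ b ⊎ b ∣ k) → Dominating G x
    comparable-with-all⇒dominating order-k comparable w w≢x =
      comparable⇒adjacent order-k (order-of w) (≢-sym w≢x) (comparable (order-of w))

    order-p-or-q-or-dominating : ∀ {x k} → IsOrder G x k → k ≡ p ⊎ k ≡ q ⊎ Dominating G x
    order-p-or-q-or-dominating {x} {k} order-k with p ∣? k | q ∣? k
    ... | yes p∣k | yes q∣k = inj₂ (inj₂ (comparable-with-all⇒dominating order-k λ order-b →
                                inj₂ (order∣ order-b (λ _ → p∣k) (λ _ → q∣k))))
    ... | yes p∣k | no  q∤k
      with prime⇒irreducible p-prime (order∣ order-k (λ _ → ∣-refl) (λ q∣k → ⊥-elim (q∤k q∣k)))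
    ...   | inj₁ refl = ⊥-elim (prime∤1 p-prime p∣k)
    ...   | inj₂ k≡p  = inj₁ k≡p
    order-p-or-q-or-dominating {x} {k} order-k | no p∤k | yes q∣k
      with prime⇒irreducible q-prime (order∣ order-k (λ p∣k → ⊥-elim (p∤k p∣k)) (λ _ → ∣-refl))
    ...   | inj₁ refl = ⊥-elim (prime∤1 q-prime q∣k)
    ...   | inj₂ k≡q  = inj₂ (inj₁ k≡q)
    order-p-or-q-or-dominating {x} {k} order-k | no p∤k | no q∤k
      with ∣1⇒≡1 (order∣ order-k (λ p∣k → ⊥-elim (p∤k p∣k)) (λ q∣k → ⊥-elim (q∤k q∣k)))
    ...   | refl = inj₂ (inj₂ (comparable-with-all⇒dominating order-k λ _ → inj₁ (1∣ _)))

    PrimeOrder : Fin n → Set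
    PrimeOrder x = ord x ≡ p ⊎ ord x ≡ q

    vertex-prime-order : ∀ (u : S**Vertex G) → PrimeOrder (value u)
    vertex-prime-order (x , [ x-nondominating ]) with order-p-or-q-or-dominating (order-of x)
    ... | inj₁ ord≡p          = inj₁ ord≡p
    ... | inj₂ (inj₁ ord≡q)   = inj₂ ord≡q
    ... | inj₂ (inj₂ x-dominating) = Irrelevant.⊥-elim (x-nondominating x-dominating)

    -- The two stars have centres hub p = 0 and hub q = 1.
    hub : ℕ → Fin (suc (suc n))
    hub k with p ∣? k
    ... | yes _ = zero
    ... | no  _ = suc zero

    leaf : Fin n → Fin (suc (suc n))
    leaf x = suc (suc x)

    hub≢leaf : ∀ k x → hub k ≢ leaf x
    hub≢leaf k x with p ∣? k
    ... | yes _ = λ ()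
    ... | no  _ = λ ()

    hub-p : hub p ≡ zero
    hub-p with p ∣? p
    ... | yes _   = refl
    ... | no  p∤p = ⊥-elim (p∤p ∣-refl)

    hub-q : hub q ≡ suc zero
    hub-q with p ∣? q
    ... | yes p∣q = ⊥-elim (proj₁ (distinct-primes-incomparable p-prime q-prime p≢q) p∣q)
    ... | no  _   = refl

    same-order⇔same-hub : ∀ {x y} → PrimeOrder x → PrimeOrder y →
                          ord x ≡ ord y ⇔ hub (ord x) ≡ hub (ord y)
    same-order⇔same-hub x-pq y-pq = mk⇔ (cong hub) (from-hub x-pq y-pq)
      where
      from-hub : ∀ {k l} → k ≡ p ⊎ k ≡ q → l ≡ p ⊎ l ≡ q → hub k ≡ hub l → k ≡ l
      from-hub (inj₁ refl) (inj₁ refl) _ = refl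
      from-hub (inj₂ refl) (inj₂ refl) _ = refl
      from-hub (inj₁ refl) (inj₂ refl) hub≡ with trans (sym hub-p) (trans hub≡ hub-q)
      ... | ()
      from-hub (inj₂ refl) (inj₁ refl) hub≡ with trans (sym hub-q) (trans hub≡ hub-p)
      ... | ()

    adjacent⇔same-order : ∀ {u w} → u ≢ w → S**Adj G u w ⇔ ord (value u) ≡ ord (value w)
    adjacent⇔same-order {u} {w} u≢w = mk⇔ (to′ (vertex-prime-order u) (vertex-prime-order w))
      (λ ord≡ → comparable⇒adjacent (order-of _) (order-of _) (λ x≡y → u≢w (value-injective x≡y))
                                    (inj₁ (∣-reflexive ord≡)))
      where
      p⊥q = distinct-primes-incomparable p-prime q-prime p≢q
      to′ : PrimeOrder (value u) → PrimeOrder (value w) → S**Adj G u w → ord (value u) ≡ ord (value w)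
      to′ x-pq y-pq u~w with ord (value u) ≟ ord (value w)
      ... | yes ord≡ = ord≡
      ... | no  ord≢ =
        ⊥-elim (incomparable⇒¬adjacent (order-of _) (order-of _) (incomparable x-pq y-pq ord≢) u~w)
        where
        incomparable : ∀ {k l} → k ≡ p ⊎ k ≡ q → l ≡ p ⊎ l ≡ q → k ≢ l → Incomparable k l
        incomparable (inj₁ refl) (inj₂ refl) _ = p⊥q
        incomparable (inj₂ refl) (inj₁ refl) _ = swap p⊥q
        incomparable (inj₁ refl) (inj₁ refl) k≢l = ⊥-elim (k≢l refl)
        incomparable (inj₂ refl) (inj₂ refl) k≢l = ⊥-elim (k≢l refl)

    star-edge : S**Vertex G → Fin (suc (suc n)) × Fin (suc (suc n))
    star-edge u = hub (ord (value u)) , leaf (value u)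

    share-end⇔same-hub : ∀ {u w} → u ≢ w →
                         ShareEnd (star-edge u) (star-edge w) ⇔ hub (ord (value u)) ≡ hub (ord (value w))
    share-end⇔same-hub {u} {w} u≢w = mk⇔ to′ (λ hub≡ → inj₁ (inj₁ hub≡))
      where
      to′ : ShareEnd (star-edge u) (star-edge w) → hub (ord (value u)) ≡ hub (ord (value w))
      to′ (inj₁ (inj₁ hub≡hub))   = hub≡hub
      to′ (inj₁ (inj₂ hub≡leaf))  = ⊥-elim (hub≢leaf _ _ hub≡leaf)
      to′ (inj₂ (inj₁ leaf≡hub))  = ⊥-elim (hub≢leaf _ _ (sym leaf≡hub))
      to′ (inj₂ (inj₂ refl))      = ⊥-elim (u≢w (value-injective refl))

    two-stars-line-graph : IsLineGraph (S**Vertex G) (S**Adj G)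
    two-stars-line-graph = edge-map⇒line-graph star-edge (λ u → hub≢leaf _ _) injective λ u w u≢w →
      ⇔.trans (adjacent⇔same-order u≢w)
        (⇔.trans (same-order⇔same-hub (vertex-prime-order u) (vertex-prime-order w))
                           (⇔.sym (share-end⇔same-hub u≢w)))
      where
      injective : ∀ u w → SameEdge (star-edge u) (star-edge w) → u ≡ w
      injective u w (inj₁ (_ , refl))   = value-injective refl
      injective u w (inj₂ (hub≡leaf , _)) = ⊥-elim (hub≢leaf _ _ hub≡leaf)

mainTheorem6 : (G : FiniteGroup) → Dominatable G →
    (IsLineGraph (S**Vertex G) (S**Adj G) ⇔ (IsPGroup G ⊎ (TwoPrimeDivisors G × AllOrdersSquareFree G)))
mainTheorem6 G dominatable = mk⇔ (line-graph⇒classified dominatable) classified⇒line-graph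
  where
  open OrderSupergraph G
  classified⇒line-graph : IsPGroup G ⊎ (TwoPrimeDivisors G × AllOrdersSquareFree G) →
                          IsLineGraph (S**Vertex G) (S**Adj G)
  classified⇒line-graph (inj₁ p-group) = p-group⇒line-graph p-group
  classified⇒line-graph (inj₂ ((_ , _ , p-prime , q-prime , p≢q , _ , _ , only-p-q) , squarefree)) =
    TwoPrimes.two-stars-line-graph p-prime q-prime p≢q only-p-q squarefree
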